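{- If $f\in\mathbb{F}[x_1,\dots,x_n]$ has degree $d$ and can be computed by an arithmetic circuit of size $s$, then for every shift $\mathbf a\in\mathbb{F}^n$ there is a homogeneous circuit of size at most $O(d^4s)$ computing all of the polynomials $f_k^{(r)}(\mathbf a,\mathbf x)$, $0\le k,r\le d$. Moreover, given access to the circuit computing $f$, this homogeneous circuit can be constructed.
   Context: $H^\ell(f)$ denotes the homogeneous component of degree $\ell$ of $f$. For $r\ge1$, $f_\ell^{(r)}(\mathbf a,\mathbf x)=\sum_{\mathbf e\in[n]^r}\big(\prod_{k=1}^r a_{e_k}\big)\,\frac{\partial^r H^\ell(f)}{\partial x_{e_1}\cdots\partial x_{e_r}}(\mathbf x)$ (formal partial derivatives), and $f_\ell^{(0)}(\mathbf a,\mathbf x)=H^\ell(f)(\mathbf x)$. A homogeneous circuit is an arithmetic circuit in which every gate computes a homogeneous polynomial. Standing assumption: $\mathbb{F}$ has characteristic zero or characteristic greater than the degrees of the polynomials considered. -}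

module Defs where

open import Level using (Level; _⊔_)
open import Algebra.Bundles using (CommutativeRing)
open import Data.Nat as ℕ using (ℕ; zero; suc; _∸_; _≤_; _<_)
open import Data.Nat.Properties using () renaming (_≟_ to _≟ℕ_)
open import Data.Fin using (Fin)
open import Data.Fin.Properties using () renaming (_≟_ to _≟F_)
open import Data.Vec as Vec using (Vec; []; _∷_; lookup)
open import Data.Vec.Properties using (≡-dec)
open import Data.List as List using (List; []; _∷_; _++_; concatMap; foldr; filter)
open import Data.Product using (Σ; ∃; _×_; _,_; proj₁; proj₂)
open import Relation.Nullary using (¬_; yes; no)
open import Relation.Binary.PropositionalEquality using (_≡_; _≢_)

record Field (c ℓ : Level) : Set (Level.suc (c ⊔ ℓ)) where
  field
    commutativeRing : CommutativeRing c ℓ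
  open CommutativeRing commutativeRing public
  field
    0≉1     : ¬ (0# ≈ 1#)
    inverse : ∀ x → ¬ (x ≈ 0#) → ∃ λ y → (x * y) ≈ 1#

module FieldDefs {c ℓ : Level} (F : Field c ℓ) where
  open Field F

  _·_ : ℕ → Carrier → Carrier
  zero  · x = 0#
  suc m · x = x + (m · x)

  CharZeroOrGreaterThan : ℕ → Set ℓ
  CharZeroOrGreaterThan d = ∀ m → 1 ≤ m → m ≤ d → ¬ ((m · 1#) ≈ 0#)

  -- Formal polynomials in n variables: finite lists of terms
  -- (coefficient, exponent vector).  Two such lists denote the same
  -- polynomial iff all their coefficients agree.

  Monomial : ℕ → Set
  Monomial n = Vec ℕ n

  Poly : ℕ → Set c
  Poly n = List (Carrier × Monomial n)

  totalDegree : ∀ {n} → Monomial n → ℕ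
  totalDegree = Vec.foldr _ ℕ._+_ 0

  coeff : ∀ {n} → Poly n → Monomial n → Carrier
  coeff [] m = 0#
  coeff ((a , e) ∷ p) m with ≡-dec _≟ℕ_ e m
  ... | yes _ = a + coeff p m
  ... | no  _ = coeff p m

  _≈P_ : ∀ {n} → Poly n → Poly n → Set ℓ
  p ≈P q = ∀ m → coeff p m ≈ coeff q m

  0P : ∀ {n} → Poly n
  0P = []

  constP : ∀ {n} → Carrier → Poly n
  constP a = (a , Vec.replicate _ 0) ∷ []

  unitVec : ∀ {n} → Fin n → Monomial n
  unitVec {suc n} Fin.zero    = 1 ∷ Vec.replicate _ 0
  unitVec {suc n} (Fin.suc i) = 0 ∷ unitVec i

  varP : ∀ {n} → Fin n → Poly n
  varP i = (1# , unitVec i) ∷ []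

  _+P_ : ∀ {n} → Poly n → Poly n → Poly n
  p +P q = p ++ q

  _*P_ : ∀ {n} → Poly n → Poly n → Poly n
  p *P q = concatMap (λ { (a , e) → List.map (λ { (b , e′) → (a * b , Vec.zipWith ℕ._+_ e e′) }) q }) p

  _⋆P_ : ∀ {n} → Carrier → Poly n → Poly n
  a ⋆P p = List.map (λ { (b , e) → (a * b , e) }) p

  H : ∀ {n} → ℕ → Poly n → Poly n
  H k p = filter (λ t → totalDegree (proj₂ t) ≟ℕ k) p

  decAt : ∀ {n} → Fin n → Monomial n → Monomial n
  decAt i e = Vec.updateAt e i (λ k → k ∸ 1)

  ∂ : ∀ {n} → Fin n → Poly n → Poly n
  ∂ i p = List.map (λ { (a , e) → (lookup e i · a , decAt i e) }) p

  ∂s : ∀ {n r} → Vec (Fin n) r → Poly n → Poly n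
  ∂s []      p = p
  ∂s (i ∷ e) p = ∂ i (∂s e p)

  prodAt : ∀ {n r} → Vec Carrier n → Vec (Fin n) r → Carrier
  prodAt a []      = 1#
  prodAt a (i ∷ e) = lookup a i * prodAt a e

  allFin : ∀ n → List (Fin n)
  allFin zero    = []
  allFin (suc n) = Fin.zero ∷ List.map Fin.suc (allFin n)

  tuples : ∀ n r → List (Vec (Fin n) r)
  tuples n zero    = [] ∷ []
  tuples n (suc r) = concatMap (λ i → List.map (i ∷_) (tuples n r)) (allFin n)

  sumP : ∀ {n} → List (Poly n) → Poly n
  sumP = foldr _+P_ 0P

  -- f_ℓ^{(r)}(a, x) as a polynomial in x (for fixed shift a)
  fder : ∀ {n} → ℕ → ℕ → Vec Carrier n → Poly n → Poly n
  fder k zero    a f = H k f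
  fder k (suc r) a f =
    sumP (List.map (λ e → prodAt a e ⋆P ∂s e (H k f)) (tuples _ (suc r)))

  IsHomogeneous : ∀ {n} → Poly n → Set ℓ
  IsHomogeneous p = ∃ λ k → ∀ m → totalDegree m ≢ k → coeff p m ≈ 0#

  HasDegree : ∀ {n} → Poly n → ℕ → Set ℓ
  HasDegree p d =
    (∀ m → d < totalDegree m → coeff p m ≈ 0#) ×
    (∃ λ m → totalDegree m ≡ d × ¬ (coeff p m ≈ 0#))

  -- Arithmetic circuits (fan-in 2) as straight-line programs: every
  -- node (input variable, field constant, + gate, × gate) is a gate,
  -- and gates only refer to earlier gates.  A value of type
  -- Circuit n s has size s (= number of nodes).

  data Gate (n k : ℕ) : Set c where
    var   : Fin n → Gate n k
    const : Carrier → Gate n k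
    add   : Fin k → Fin k → Gate n k
    mul   : Fin k → Fin k → Gate n k

  data Circuit (n : ℕ) : ℕ → Set c where
    []  : Circuit n 0
    _▷_ : ∀ {k} → Circuit n k → Gate n k → Circuit n (suc k)

  gateSem : ∀ {n k} → Gate n k → Vec (Poly n) k → Poly n
  gateSem (var i)   v = varP i
  gateSem (const a) v = constP a
  gateSem (add i j) v = lookup v i +P lookup v j
  gateSem (mul i j) v = lookup v i *P lookup v j

  evalAll : ∀ {n k} → Circuit n k → Vec (Poly n) k
  evalAll []      = []
  evalAll (C ▷ g) = gateSem g (evalAll C) ∷ evalAll C

  gatePoly : ∀ {n k} → Circuit n k → Fin k → Poly n
  gatePoly C i = lookup (evalAll C) i

  Computes : ∀ {n k} → Circuit n k → Poly n → Set ℓ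
  Computes {k = k} C f = Σ (Fin k) λ i → gatePoly C i ≈P f

  IsHomogeneousCircuit : ∀ {n k} → Circuit n k → Set ℓ
  IsHomogeneousCircuit C = ∀ i → IsHomogeneous (gatePoly C i)

module Submission where

-- For a fixed shift a let D = Σᵢ aᵢ ∂ᵢ be the
-- directional derivative.  Unfolding the definition, f_k^{(r)} = Dʳ(Hᵏ f),
-- and since D lowers degrees by exactly one this is H^{k-r}(Dʳ f) when
-- r ≤ k and 0 otherwise.  So it suffices to build a homogeneous circuit
-- containing, for every gate g of the given circuit and all r, j ≤ d, a
-- gate computing the table entry Hʲ(Dʳ g).  Tables are built gate by gate:
--   * variables and constants: every entry is a variable, a constant or 0;
--   * g₁ + g₂: entrywise sums, since Hʲ and Dʳ are additive;
--   * g₁ · g₂: by the Leibniz rule Dᵐ⁺¹(PQ) = Dᵐ(DP·Q) + Dᵐ(P·DQ) the cells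
--     Hᵏ(Dᵐ(D^q g₁ · D^p g₂)), q + p + m ≤ d, are computed layer by layer
--     in m; layer 0 uses Hᵏ(PQ) = Σ_{j≤k} HʲP · H^{k-j}Q.
-- Each gate costs at most 3(d+1)⁴ new gates, so the size is ≤ 4(d+1)⁴ s.

open import Defs
open import Level using (Level; _⊔_)
open import Data.Bool using (Bool; true; false; if_then_else_)
open import Data.Empty using (⊥-elim)
open import Data.Fin using (Fin)
import Data.Fin.Properties as FinP
open import Data.List as List using (List; []; _∷_; _++_)
import Data.List.Properties as ListP
open import Data.Nat as ℕ using (ℕ; zero; suc; _∸_; _≤_; _<_; z≤n; s≤s)
import Data.Nat.Properties as ℕP
open import Data.Nat.Tactic.RingSolver using (solve-∀)
open import Data.Product using (Σ; _×_; _,_; proj₁; proj₂)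
open import Data.Sum using (inj₁; inj₂)
open import Data.Vec as Vec using (Vec; []; _∷_; lookup)
open import Data.Vec.Properties using (≡-dec; lookup-zipWith; lookup-replicate)
open import Function using (_∘_)
open import Relation.Binary.PropositionalEquality as ≡ using (_≡_; _≢_)
open import Relation.Binary.Bundles using (Setoid)
open import Relation.Nullary using (yes; no; Dec)

-- Exponent vectors.  'deg' and 'lower' coincide definitionally with
-- FieldDefs.totalDegree and FieldDefs.decAt; they are restated here
-- because they do not depend on the field.
module Exponents where
  open import Data.Nat using (_+_)

  deg : ∀ {n} → Vec ℕ n → ℕ
  deg = Vec.foldr _ _+_ 0

  _⊕_ : ∀ {n} → Vec ℕ n → Vec ℕ n → Vec ℕ n
  e ⊕ e′ = Vec.zipWith _+_ e e′

  lower : ∀ {n} → Fin n → Vec ℕ n → Vec ℕ n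
  lower i e = Vec.updateAt e i (_∸ 1)

  deg-⊕ : ∀ {n} (e e′ : Vec ℕ n) → deg (e ⊕ e′) ≡ deg e + deg e′
  deg-⊕ []      []        = ≡.refl
  deg-⊕ (x ∷ e) (y ∷ e′) rewrite deg-⊕ e e′ = interchange x y (deg e) (deg e′)
    where
    interchange : ∀ a b c d → (a + b) + (c + d) ≡ (a + c) + (b + d)
    interchange = solve-∀

  lower-⊕ˡ : ∀ {n} (e e′ : Vec ℕ n) i {x} → lookup e i ≡ suc x → lower i (e ⊕ e′) ≡ lower i e ⊕ e′
  lower-⊕ˡ (suc x ∷ e) (y ∷ e′) Fin.zero    ≡.refl = ≡.refl
  lower-⊕ˡ (x ∷ e)     (y ∷ e′) (Fin.suc i) eq     = ≡.cong (x + y ∷_) (lower-⊕ˡ e e′ i eq)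

  lower-⊕ʳ : ∀ {n} (e e′ : Vec ℕ n) i {x} → lookup e′ i ≡ suc x → lower i (e ⊕ e′) ≡ e ⊕ lower i e′
  lower-⊕ʳ (x ∷ e) (suc y ∷ e′) Fin.zero    ≡.refl = ≡.cong (λ z → z ∸ 1 ∷ (e ⊕ e′)) (ℕP.+-suc x y)
  lower-⊕ʳ (x ∷ e) (y ∷ e′)     (Fin.suc i) eq     = ≡.cong (x + y ∷_) (lower-⊕ʳ e e′ i eq)

  deg-lower : ∀ {n} (e : Vec ℕ n) i {x} → lookup e i ≡ suc x → deg e ≡ suc (deg (lower i e))
  deg-lower (suc x ∷ e) Fin.zero    ≡.refl = ≡.refl
  deg-lower (x ∷ e)     (Fin.suc i) eq     = ≡.trans (≡.cong (x +_) (deg-lower e i eq)) (ℕP.+-suc x _)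

  deg-replicate0 : ∀ n → deg (Vec.replicate n 0) ≡ 0
  deg-replicate0 zero    = ≡.refl
  deg-replicate0 (suc n) = deg-replicate0 n

module DegreeTests where
  open import Data.Bool.Properties using (T-≡; ¬-not)
  open import Function.Bundles using (Equivalence)
  open import Data.Nat using (_+_; _≡ᵇ_)

  ≡ᵇ-true⇒≡ : ∀ u v → (u ≡ᵇ v) ≡ true → u ≡ v
  ≡ᵇ-true⇒≡ u v eq = ℕP.≡ᵇ⇒≡ u v (Equivalence.from T-≡ eq)

  ≡ᵇ-refl : ∀ u → (u ≡ᵇ u) ≡ true
  ≡ᵇ-refl u = Equivalence.to T-≡ (ℕP.≡⇒≡ᵇ u u ≡.refl)

  ≢⇒≡ᵇ-false : ∀ u v → u ≢ v → (u ≡ᵇ v) ≡ false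
  ≢⇒≡ᵇ-false u v u≢v = ¬-not (λ eq → u≢v (≡ᵇ-true⇒≡ u v eq))

  -- u ≤ k as a boolean, with the recursion used by 'choose-diagonal'
  atMost : ℕ → ℕ → Bool
  atMost zero    k       = true
  atMost (suc u) zero    = false
  atMost (suc u) (suc k) = atMost u k

  atMost-refl : ∀ k → atMost k k ≡ true
  atMost-refl zero    = ≡.refl
  atMost-refl (suc k) = atMost-refl k

  atMost-suc : ∀ k → atMost (suc k) k ≡ false
  atMost-suc zero    = ≡.refl
  atMost-suc (suc k) = atMost-suc k

  atMost-step : ∀ u k → (u ≡ᵇ suc k) ≡ false → atMost u (suc k) ≡ atMost u k
  atMost-step zero          k       eq = ≡.refl
  atMost-step (suc zero)    zero    ()
  atMost-step (suc (suc u)) zero    eq = ≡.refl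
  atMost-step (suc u)       (suc k) eq = atMost-step u k eq

  choose-diagonal : ∀ {a} {A : Set a} (x y : A) u v k →
    (if atMost u k then (if v ≡ᵇ k ∸ u then x else y) else y) ≡ (if u + v ≡ᵇ k then x else y)
  choose-diagonal x y zero    v k       = ≡.refl
  choose-diagonal x y (suc u) v zero    = ≡.refl
  choose-diagonal x y (suc u) v (suc k) = choose-diagonal x y u v k

module PolynomialAlgebra {c ℓ : Level} (F : Field c ℓ) where
  open Field F
  open FieldDefs F
  open Exponents using (_⊕_)
  open import Relation.Binary.Reasoning.Setoid setoid
  import Algebra.Properties.CommutativeSemigroup as CommSemigroupProps
  module +-Props = CommSemigroupProps +-commutativeSemigroup
  module *-Props = CommSemigroupProps *-commutativeSemigroup
  open import Algebra.Properties.Semiring.Mult semiring using (×-congʳ; ×-homo-+; ×-comm-*; ×-assoc-*) renaming (_×_ to _×ₘ_)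
  open import Algebra.Properties.CommutativeMonoid.Mult +-commutativeMonoid using (×-distrib-+)

  _≟M_ : ∀ {n} (e m : Monomial n) → Dec (e ≡ m)
  _≟M_ = ≡-dec ℕ._≟_

  -- The scalar multiple k · x of Defs is the library's monoid multiple k ×ₘ x,
  -- so its laws are inherited.
  ·≡× : ∀ k x → k · x ≡ k ×ₘ x
  ·≡× zero    x = ≡.refl
  ·≡× (suc k) x = ≡.cong (x +_) (·≡× k x)

  ·-cong : ∀ k {x y} → x ≈ y → k · x ≈ k · y
  ·-cong k {x} {y} eq rewrite ·≡× k x | ·≡× k y = ×-congʳ k eq

  ·-distrib-+ : ∀ k x y → k · (x + y) ≈ k · x + k · y
  ·-distrib-+ k x y rewrite ·≡× k (x + y) | ·≡× k x | ·≡× k y = ×-distrib-+ x y k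

  ·-homo-+ : ∀ j k x → (j ℕ.+ k) · x ≈ j · x + k · x
  ·-homo-+ j k x rewrite ·≡× (j ℕ.+ k) x | ·≡× j x | ·≡× k x = ×-homo-+ x j k

  ·-assoc-* : ∀ k x y → k · (x * y) ≈ (k · x) * y
  ·-assoc-* k x y rewrite ·≡× k (x * y) | ·≡× k x = sym (×-assoc-* k x y)

  ·-comm-* : ∀ k x y → k · (x * y) ≈ x * (k · y)
  ·-comm-* k x y rewrite ·≡× k (x * y) | ·≡× k y = sym (×-comm-* k x y)

  ·-zero : ∀ k → k · 0# ≈ 0#
  ·-zero k = begin
    k · 0#          ≈⟨ ·-cong k (sym (zeroˡ 0#)) ⟩
    k · (0# * 0#)   ≈⟨ ·-comm-* k 0# 0# ⟩
    0# * (k · 0#)   ≈⟨ zeroˡ _ ⟩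
    0#              ∎

  -- Term sums.  A polynomial is a list of terms; 'termSum G p' adds up
  -- G e a over its terms a·xᵉ.  Coefficients, H, ∂ and products are all
  -- expressed as term sums of suitable maps G.

  TermMap : ℕ → Set c
  TermMap n = Monomial n → Carrier → Carrier

  termSum : ∀ {n} → TermMap n → Poly n → Carrier
  termSum G []            = 0#
  termSum G ((a , e) ∷ p) = G e a + termSum G p

  record Additive {n} (G : TermMap n) : Set (c ⊔ ℓ) where
    field
      resp-≈ : ∀ e {a b} → a ≈ b → G e a ≈ G e b
      hom-+  : ∀ e a b → G e (a + b) ≈ G e a + G e b
      hom-0  : ∀ e → G e 0# ≈ 0#
  open Additive public

  without : ∀ {n} → Monomial n → Poly n → Poly n
  without e [] = []
  without e ((a , e′) ∷ p) with e′ ≟M e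
  ... | yes _ = without e p
  ... | no  _ = (a , e′) ∷ without e p

  termSum-split : ∀ {n} {G : TermMap n} → Additive G → ∀ e p →
    termSum G p ≈ G e (coeff p e) + termSum G (without e p)
  termSum-split A e [] = sym (trans (+-identityʳ _) (hom-0 A e))
  termSum-split {G = G} A e ((b , e′) ∷ p) with e′ ≟M e
  ... | yes ≡.refl = begin
      G e b + termSum G p                                     ≈⟨ +-congˡ (termSum-split A e p) ⟩
      G e b + (G e (coeff p e) + termSum G (without e p))     ≈⟨ sym (+-assoc _ _ _) ⟩
      (G e b + G e (coeff p e)) + termSum G (without e p)     ≈⟨ +-congʳ (sym (hom-+ A e _ _)) ⟩
      G e (b + coeff p e) + termSum G (without e p)           ∎
  ... | no _ = begin
      G e′ b + termSum G p                                    ≈⟨ +-congˡ (termSum-split A e p) ⟩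
      G e′ b + (G e (coeff p e) + termSum G (without e p))    ≈⟨ +-Props.x∙yz≈y∙xz _ _ _ ⟩
      G e (coeff p e) + (G e′ b + termSum G (without e p))    ∎

  coeff-without-same : ∀ {n} e (p : Poly n) → coeff (without e p) e ≈ 0#
  coeff-without-same e [] = refl
  coeff-without-same e ((a , e′) ∷ p) with e′ ≟M e
  ... | yes _ = coeff-without-same e p
  ... | no e′≢e with e′ ≟M e
  ...   | yes e′≡e = ⊥-elim (e′≢e e′≡e)
  ...   | no _     = coeff-without-same e p

  coeff-without-other : ∀ {n} e m (p : Poly n) → m ≢ e → coeff (without e p) m ≈ coeff p m
  coeff-without-other e m [] m≢e = refl
  coeff-without-other e m ((a , e′) ∷ p) m≢e with e′ ≟M e
  coeff-without-other e m ((a , e′) ∷ p) m≢e | yes ≡.refl with e ≟M m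
  ... | yes ≡.refl = ⊥-elim (m≢e ≡.refl)
  ... | no _       = coeff-without-other e m p m≢e
  coeff-without-other e m ((a , e′) ∷ p) m≢e | no _ with e′ ≟M m
  ... | yes _ = +-congˡ (coeff-without-other e m p m≢e)
  ... | no _  = coeff-without-other e m p m≢e

  length-without : ∀ {n} e (p : Poly n) → List.length (without e p) ≤ List.length p
  length-without e [] = z≤n
  length-without e ((a , e′) ∷ p) with e′ ≟M e
  ... | yes _ = ℕP.m≤n⇒m≤1+n (length-without e p)
  ... | no _  = s≤s (length-without e p)

  length-without-head : ∀ {n} a e (p : Poly n) → List.length (without e ((a , e) ∷ p)) < suc (List.length p)
  length-without-head a e p with e ≟M e
  ... | yes _   = s≤s (length-without e p)
  ... | no e≢e = ⊥-elim (e≢e ≡.refl)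

  -- Proved by removing one monomial at a time from both polynomials,
  -- by recursion on a bound N for their total length.
  termSum-transfer : ∀ {n} {G G′ : TermMap n} → Additive G → Additive G′ →
    ∀ p q → (∀ e → G e (coeff p e) ≈ G′ e (coeff q e)) → termSum G p ≈ termSum G′ q
  termSum-transfer {G = G} {G′} A A′ p q = bounded _ p q ℕP.≤-refl
    where
    bounded : ∀ N p q → List.length p ℕ.+ List.length q ≤ N →
      (∀ e → G e (coeff p e) ≈ G′ e (coeff q e)) → termSum G p ≈ termSum G′ q
    remove : ∀ N e p q → List.length (without e p) ℕ.+ List.length (without e q) ≤ N →
      (∀ e → G e (coeff p e) ≈ G′ e (coeff q e)) → termSum G p ≈ termSum G′ q
    remove N e p q len h = begin
      termSum G p                                    ≈⟨ termSum-split A e p ⟩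
      G e (coeff p e) + termSum G (without e p)      ≈⟨ +-cong (h e) (bounded N (without e p) (without e q) len h′) ⟩
      G′ e (coeff q e) + termSum G′ (without e q)    ≈⟨ sym (termSum-split A′ e q) ⟩
      termSum G′ q                                   ∎
      where
      h′ : ∀ m → G m (coeff (without e p) m) ≈ G′ m (coeff (without e q) m)
      h′ m with m ≟M e
      ... | yes ≡.refl = trans (resp-≈ A e (coeff-without-same e p))
                          (trans (hom-0 A e) (sym (trans (resp-≈ A′ e (coeff-without-same e q)) (hom-0 A′ e))))
      ... | no m≢e = trans (resp-≈ A m (coeff-without-other e m p m≢e))
                       (trans (h m) (sym (resp-≈ A′ m (coeff-without-other e m q m≢e))))
    bounded N [] [] _ h = refl
    bounded (suc N) ((a , e) ∷ p) q len h =
      remove N e ((a , e) ∷ p) q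
        (ℕP.≤-pred (ℕP.≤-trans (ℕP.+-mono-≤ (length-without-head a e p) (length-without e q)) len)) h
    bounded (suc N) [] ((b , e) ∷ q) len h =
      remove N e [] ((b , e) ∷ q) (ℕP.≤-pred (ℕP.≤-trans (length-without-head b e q) len)) h
    bounded zero ((a , e) ∷ p) q () h
    bounded zero [] ((b , e) ∷ q) () h

  termSum-vanishes : ∀ {n} {G : TermMap n} → Additive G → ∀ p →
    (∀ e → G e (coeff p e) ≈ 0#) → termSum G p ≈ 0#
  termSum-vanishes A p h = termSum-transfer A A p [] (λ e → trans (h e) (sym (hom-0 A e)))

  termSum-++ : ∀ {n} (G : TermMap n) p q → termSum G (p ++ q) ≈ termSum G p + termSum G q
  termSum-++ G []            q = sym (+-identityˡ _)
  termSum-++ G ((a , e) ∷ p) q = trans (+-congˡ (termSum-++ G p q)) (sym (+-assoc _ _ _))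

  termSum-ext : ∀ {n} {G G′ : TermMap n} → (∀ e a → G e a ≈ G′ e a) → ∀ p → termSum G p ≈ termSum G′ p
  termSum-ext h []            = refl
  termSum-ext h ((a , e) ∷ p) = +-cong (h e a) (termSum-ext h p)

  termSum-+ : ∀ {n} (G G′ : TermMap n) p → termSum (λ e a → G e a + G′ e a) p ≈ termSum G p + termSum G′ p
  termSum-+ G G′ []            = sym (+-identityˡ _)
  termSum-+ G G′ ((a , e) ∷ p) = trans (+-congˡ (termSum-+ G G′ p)) (+-Props.interchange _ _ _ _)

  termSum-0 : ∀ {n} {G : TermMap n} → (∀ e a → G e a ≈ 0#) → ∀ p → termSum G p ≈ 0#
  termSum-0 h []            = refl
  termSum-0 h ((a , e) ∷ p) = trans (+-cong (h e a) (termSum-0 h p)) (+-identityˡ _)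

  termSum-map : ∀ {n} (G : TermMap n) (f : Carrier × Monomial n → Carrier × Monomial n) p →
    termSum G (List.map f p) ≡ termSum (λ e a → G (proj₂ (f (a , e))) (proj₁ (f (a , e)))) p
  termSum-map G f []            = ≡.refl
  termSum-map G f ((a , e) ∷ p) = ≡.cong (G (proj₂ (f (a , e))) (proj₁ (f (a , e))) +_) (termSum-map G f p)

  termSum-scale : ∀ {n} (G : TermMap n) b p → b * termSum G p ≈ termSum (λ e a → b * G e a) p
  termSum-scale G b []            = zeroʳ b
  termSum-scale G b ((a , e) ∷ p) = trans (distribˡ b _ _) (+-congˡ (termSum-scale G b p))

  termSum-additive : ∀ {n} (G : Monomial n → Monomial n → Carrier → Carrier → Carrier) →
    (∀ e′ b → Additive (λ e a → G e e′ a b)) → ∀ q → Additive (λ e a → termSum (λ e′ b → G e e′ a b) q)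
  termSum-additive G A q = record
    { resp-≈ = λ e eq → termSum-ext (λ e′ b → resp-≈ (A e′ b) e eq) q
    ; hom-+  = λ e a a′ → trans (termSum-ext (λ e′ b → hom-+ (A e′ b) e a a′) q) (termSum-+ _ _ q)
    ; hom-0  = λ e → termSum-0 (λ e′ b → hom-0 (A e′ b) e) q }

  δ : ∀ {n} → Monomial n → TermMap n
  δ m e a with e ≟M m
  ... | yes _ = a
  ... | no _  = 0#

  δ-cong : ∀ {n} (m e : Monomial n) {a b} → a ≈ b → δ m e a ≈ δ m e b
  δ-cong m e eq with e ≟M m
  ... | yes _ = eq
  ... | no _  = refl

  δ-+ : ∀ {n} (m e : Monomial n) a b → δ m e (a + b) ≈ δ m e a + δ m e b
  δ-+ m e a b with e ≟M m
  ... | yes _ = refl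
  ... | no _  = sym (+-identityʳ _)

  δ-0 : ∀ {n} (m e : Monomial n) → δ m e 0# ≈ 0#
  δ-0 m e with e ≟M m
  ... | yes _ = refl
  ... | no _  = refl

  δ-≈0 : ∀ {n} (m e : Monomial n) {x} → x ≈ 0# → δ m e x ≈ 0#
  δ-≈0 m e eq = trans (δ-cong m e eq) (δ-0 m e)

  δ-* : ∀ {n} (m e : Monomial n) c a → δ m e (c * a) ≈ c * δ m e a
  δ-* m e c a with e ≟M m
  ... | yes _ = refl
  ... | no _  = sym (zeroʳ c)

  δ-≢ : ∀ {n} (m e : Monomial n) x → e ≢ m → δ m e x ≈ 0#
  δ-≢ m e x e≢m with e ≟M m
  ... | yes e≡m = ⊥-elim (e≢m e≡m)
  ... | no _    = refl

  δ-additive : ∀ {n} (m : Monomial n) (τ : Monomial n → Monomial n) {φ : TermMap n} →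
    Additive φ → Additive (λ e a → δ m (τ e) (φ e a))
  δ-additive m τ A = record
    { resp-≈ = λ e eq → δ-cong m (τ e) (resp-≈ A e eq)
    ; hom-+  = λ e a b → trans (δ-cong m (τ e) (hom-+ A e a b)) (δ-+ m (τ e) _ _)
    ; hom-0  = λ e → δ-≈0 m (τ e) (hom-0 A e) }

  identity-additive : ∀ {n} → Additive {n} (λ e a → a)
  identity-additive = record { resp-≈ = λ e eq → eq ; hom-+ = λ e a b → refl ; hom-0 = λ e → refl }

  scaleˡ-additive : ∀ {n} (b : Carrier) → Additive {n} (λ e a → b * a)
  scaleˡ-additive b = record { resp-≈ = λ e eq → *-congˡ eq ; hom-+ = λ e a a′ → distribˡ b a a′ ; hom-0 = λ e → zeroʳ b }

  multiple-additive : ∀ {n} (κ : Monomial n → ℕ) → Additive {n} (λ e a → κ e · a)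
  multiple-additive κ = record
    { resp-≈ = λ e eq → ·-cong (κ e) eq ; hom-+ = λ e a b → ·-distrib-+ (κ e) a b ; hom-0 = λ e → ·-zero (κ e) }

  coeff-termSum : ∀ {n} (p : Poly n) m → coeff p m ≈ termSum (δ m) p
  coeff-termSum [] m = refl
  coeff-termSum ((a , e) ∷ p) m with e ≟M m
  ... | yes _ = +-congˡ (coeff-termSum p m)
  ... | no _  = trans (coeff-termSum p m) (sym (+-identityˡ _))

  coeff-++ : ∀ {n} (p q : Poly n) m → coeff (p ++ q) m ≈ coeff p m + coeff q m
  coeff-++ [] q m = sym (+-identityˡ _)
  coeff-++ ((a , e) ∷ p) q m with e ≟M m
  ... | yes _ = trans (+-congˡ (coeff-++ p q m)) (sym (+-assoc _ _ _))
  ... | no _  = coeff-++ p q m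

  productTerm : ∀ {n} → Poly n → Monomial n → TermMap n
  productTerm q m e a = termSum (λ e′ b → δ m (e ⊕ e′) (a * b)) q

  productTerm-additive : ∀ {n} (q : Poly n) m → Additive (productTerm q m)
  productTerm-additive q m = termSum-additive (λ e e′ a b → δ m (e ⊕ e′) (a * b))
    (λ e′ b → record
      { resp-≈ = λ e eq → δ-cong m (e ⊕ e′) (*-congʳ eq)
      ; hom-+  = λ e a a′ → trans (δ-cong m (e ⊕ e′) (distribʳ b a a′)) (δ-+ m (e ⊕ e′) _ _)
      ; hom-0  = λ e → δ-≈0 m (e ⊕ e′) (zeroˡ b) }) q

  termSum-* : ∀ {n} (G : TermMap n) (p q : Poly n) →
    termSum G (p *P q) ≈ termSum (λ e a → termSum (λ e′ b → G (e ⊕ e′) (a * b)) q) p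
  termSum-* G [] q = refl
  termSum-* G ((a , e) ∷ p) q = begin
    termSum G (List.map scaleBy q ++ (p *P q))                ≈⟨ termSum-++ G (List.map scaleBy q) (p *P q) ⟩
    termSum G (List.map scaleBy q) + termSum G (p *P q)       ≈⟨ +-cong (reflexive (termSum-map G scaleBy q)) (termSum-* G p q) ⟩
    _                                                         ∎
    where
    scaleBy : Carrier × Monomial _ → Carrier × Monomial _
    scaleBy t = a * proj₁ t , e ⊕ proj₂ t

  coeff-* : ∀ {n} (p q : Poly n) m → coeff (p *P q) m ≈ termSum (productTerm q m) p
  coeff-* p q m = trans (coeff-termSum (p *P q) m) (termSum-* (δ m) p q)

  -- Equality of polynomials, wrapped in a record so that the two sides
  -- can be inferred from a proof.

  infix 4 _≋_
  record _≋_ {n} (p q : Poly n) : Set ℓ where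
    constructor ⟪_⟫
    field at : p ≈P q
  open _≋_ public

  ≋-refl : ∀ {n} {p : Poly n} → p ≋ p
  ≋-refl = ⟪ (λ m → refl) ⟫

  ≋-sym : ∀ {n} {p q : Poly n} → p ≋ q → q ≋ p
  ≋-sym h = ⟪ (λ m → sym (at h m)) ⟫

  ≋-trans : ∀ {n} {p q r : Poly n} → p ≋ q → q ≋ r → p ≋ r
  ≋-trans h h′ = ⟪ (λ m → trans (at h m) (at h′ m)) ⟫

  ≋-reflexive : ∀ {n} {p q : Poly n} → p ≡ q → p ≋ q
  ≋-reflexive ≡.refl = ≋-refl

  ≋-setoid : ℕ → Setoid c ℓ
  ≋-setoid n = record
    { Carrier = Poly n ; _≈_ = _≋_
    ; isEquivalence = record { refl = ≋-refl ; sym = ≋-sym ; trans = ≋-trans } }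

  termSum-cong : ∀ {n} {G : TermMap n} → Additive G → ∀ {p q} → p ≋ q → termSum G p ≈ termSum G q
  termSum-cong A {p} {q} h = termSum-transfer A A p q (λ e → resp-≈ A e (at h e))

  ++-cong : ∀ {n} {p p′ q q′ : Poly n} → p ≋ p′ → q ≋ q′ → p ++ q ≋ p′ ++ q′
  ++-cong {p = p} {p′} {q} {q′} h h′ = ⟪ (λ m →
    trans (coeff-++ p q m) (trans (+-cong (at h m) (at h′ m)) (sym (coeff-++ p′ q′ m)))) ⟫

  ++-interchange : ∀ {n} (p q r s : Poly n) → (p ++ q) ++ (r ++ s) ≋ (p ++ r) ++ (q ++ s)
  ++-interchange p q r s = ⟪ (λ m → begin
    coeff ((p ++ q) ++ (r ++ s)) m                  ≈⟨ coeff-++ (p ++ q) (r ++ s) m ⟩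
    coeff (p ++ q) m + coeff (r ++ s) m             ≈⟨ +-cong (coeff-++ p q m) (coeff-++ r s m) ⟩
    (coeff p m + coeff q m) + (coeff r m + coeff s m) ≈⟨ +-Props.interchange _ _ _ _ ⟩
    (coeff p m + coeff r m) + (coeff q m + coeff s m) ≈⟨ sym (+-cong (coeff-++ p r m) (coeff-++ q s m)) ⟩
    coeff (p ++ r) m + coeff (q ++ s) m             ≈⟨ sym (coeff-++ (p ++ r) (q ++ s) m) ⟩
    coeff ((p ++ r) ++ (q ++ s)) m                  ∎) ⟫

  *P-cong : ∀ {n} {p p′ q q′ : Poly n} → p ≋ p′ → q ≋ q′ → p *P q ≋ p′ *P q′
  *P-cong {p = p} {p′} {q} {q′} h h′ = ⟪ (λ m → begin
    coeff (p *P q) m                ≈⟨ coeff-* p q m ⟩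
    termSum (productTerm q m) p     ≈⟨ termSum-cong (productTerm-additive q m) h ⟩
    termSum (productTerm q m) p′    ≈⟨ termSum-ext (λ e a → termSum-cong (δ-additive m (e ⊕_) (scaleˡ-additive a)) h′) p′ ⟩
    termSum (productTerm q′ m) p′   ≈⟨ sym (coeff-* p′ q′ m) ⟩
    coeff (p′ *P q′) m              ∎) ⟫

  single-zero : ∀ {n} x (M : Monomial n) → x ≈ 0# → (x , M) ∷ [] ≋ []
  single-zero x M x≈0 = ⟪ (λ m → coefficient m) ⟫
    where
    coefficient : ∀ m → coeff ((x , M) ∷ []) m ≈ 0#
    coefficient m with M ≟M m
    ... | yes _ = trans (+-identityʳ x) x≈0
    ... | no _  = refl

  single-cong : ∀ {n} {x y} {M M′ : Monomial n} → x ≈ y → M ≡ M′ → (x , M) ∷ [] ≋ (y , M′) ∷ []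
  single-cong {M = M} x≈y ≡.refl = ⟪ (λ m → coefficient m) ⟫
    where
    coefficient : ∀ m → coeff ((_ , M) ∷ []) m ≈ coeff ((_ , M) ∷ []) m
    coefficient m with M ≟M m
    ... | yes _ = +-congʳ x≈y
    ... | no _  = refl

  ifDeg : ∀ {n} → ℕ → Monomial n → Carrier → Carrier
  ifDeg k e x = if totalDegree e ℕ.≡ᵇ k then x else 0#

  ifDeg-cong : ∀ {n} k (e : Monomial n) {x y} → x ≈ y → ifDeg k e x ≈ ifDeg k e y
  ifDeg-cong k e eq with totalDegree e ℕ.≡ᵇ k
  ... | true  = eq
  ... | false = refl

  ifDeg-0 : ∀ {n} k (e : Monomial n) → ifDeg k e 0# ≈ 0#
  ifDeg-0 k e with totalDegree e ℕ.≡ᵇ k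
  ... | true  = refl
  ... | false = refl

  ifDeg-+ : ∀ {n} k (e : Monomial n) x y → ifDeg k e (x + y) ≈ ifDeg k e x + ifDeg k e y
  ifDeg-+ k e x y with totalDegree e ℕ.≡ᵇ k
  ... | true  = refl
  ... | false = sym (+-identityʳ _)

  ifDeg-* : ∀ {n} k (e : Monomial n) c x → ifDeg k e (c * x) ≈ c * ifDeg k e x
  ifDeg-* k e c x with totalDegree e ℕ.≡ᵇ k
  ... | true  = refl
  ... | false = sym (zeroʳ c)

  ifDeg-termSum : ∀ {n} j (e : Monomial n) (G : TermMap n) (q : Poly n) →
    ifDeg j e (termSum G q) ≈ termSum (λ e′ b → ifDeg j e (G e′ b)) q
  ifDeg-termSum j e G q with totalDegree e ℕ.≡ᵇ j
  ... | true  = refl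
  ... | false = sym (termSum-0 (λ e′ b → refl) q)

  ifDeg-additive : ∀ {n} k {G : TermMap n} → Additive G → Additive (λ e a → ifDeg k e (G e a))
  ifDeg-additive k A = record
    { resp-≈ = λ e eq → ifDeg-cong k e (resp-≈ A e eq)
    ; hom-+  = λ e a b → trans (ifDeg-cong k e (hom-+ A e a b)) (ifDeg-+ k e _ _)
    ; hom-0  = λ e → trans (ifDeg-cong k e (hom-0 A e)) (ifDeg-0 k e) }

  termSum-H : ∀ {n} (G : TermMap n) k p → termSum G (H k p) ≈ termSum (λ e a → ifDeg k e (G e a)) p
  termSum-H G k [] = refl
  termSum-H G k ((a , e) ∷ p) with totalDegree e ℕ.≡ᵇ k
  ... | true  = +-congˡ (termSum-H G k p)
  ... | false = trans (termSum-H G k p) (sym (+-identityˡ _))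

  coeff-H : ∀ {n} k (p : Poly n) m → coeff (H k p) m ≈ termSum (λ e a → ifDeg k e (δ m e a)) p
  coeff-H k p m = trans (coeff-termSum (H k p) m) (termSum-H (δ m) k p)

  H-cong : ∀ {n} k {p q : Poly n} → p ≋ q → H k p ≋ H k q
  H-cong k {p} {q} h = ⟪ (λ m → trans (coeff-H k p m)
    (trans (termSum-cong (ifDeg-additive k (δ-additive m (λ e → e) identity-additive)) h) (sym (coeff-H k q m)))) ⟫

  H-++ : ∀ {n} k (p q : Poly n) → H k (p ++ q) ≡ H k p ++ H k q
  H-++ k p q = ListP.filter-++ (λ t → totalDegree (proj₂ t) ℕ.≟ k) p q

  coeff-⋆ : ∀ {n} c (p : Poly n) m → coeff (c ⋆P p) m ≈ c * coeff p m
  coeff-⋆ c [] m = sym (zeroʳ c)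
  coeff-⋆ c ((a , e) ∷ p) m with e ≟M m
  ... | yes _ = trans (+-congˡ (coeff-⋆ c p m)) (sym (distribˡ c _ _))
  ... | no _  = coeff-⋆ c p m

  ⋆-congʳ : ∀ {n} c {p q : Poly n} → p ≋ q → c ⋆P p ≋ c ⋆P q
  ⋆-congʳ c {p} {q} h = ⟪ (λ m → trans (coeff-⋆ c p m) (trans (*-congˡ (at h m)) (sym (coeff-⋆ c q m)))) ⟫

  ⋆-++ : ∀ {n} c (p q : Poly n) → c ⋆P (p ++ q) ≡ (c ⋆P p) ++ (c ⋆P q)
  ⋆-++ c p q = ListP.map-++ _ p q

  ⋆-⋆ : ∀ {n} c c′ (p : Poly n) → c ⋆P (c′ ⋆P p) ≋ (c * c′) ⋆P p
  ⋆-⋆ c c′ p = ⟪ (λ m → trans (coeff-⋆ c (c′ ⋆P p) m) (trans (*-congˡ (coeff-⋆ c′ p m))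
    (trans (sym (*-assoc _ _ _)) (sym (coeff-⋆ _ p m))))) ⟫

  ⋆-identity : ∀ {n} (p : Poly n) → 1# ⋆P p ≋ p
  ⋆-identity p = ⟪ (λ m → trans (coeff-⋆ 1# p m) (*-identityˡ _)) ⟫

  termSum-⋆ : ∀ {n} (G : TermMap n) c (p : Poly n) → termSum G (c ⋆P p) ≡ termSum (λ e a → G e (c * a)) p
  termSum-⋆ G c p = termSum-map G (λ t → c * proj₁ t , proj₂ t) p

  ⋆-commute : ∀ {n} (T : Poly n → Poly n) (G : Monomial n → TermMap n) →
    (∀ p m → coeff (T p) m ≈ termSum (G m) p) →
    (∀ m c e a → G m e (c * a) ≈ c * G m e a) →
    ∀ c p → T (c ⋆P p) ≋ c ⋆P T p
  ⋆-commute T G coeff-T G-* c p = ⟪ (λ m → begin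
    coeff (T (c ⋆P p)) m                  ≈⟨ coeff-T (c ⋆P p) m ⟩
    termSum (G m) (c ⋆P p)                ≡⟨ termSum-⋆ (G m) c p ⟩
    termSum (λ e a → G m e (c * a)) p     ≈⟨ termSum-ext (G-* m c) p ⟩
    termSum (λ e a → c * G m e a) p       ≈⟨ sym (termSum-scale (G m) c p) ⟩
    c * termSum (G m) p                   ≈⟨ *-congˡ (sym (coeff-T p m)) ⟩
    c * coeff (T p) m                     ≈⟨ sym (coeff-⋆ c (T p) m) ⟩
    coeff (c ⋆P T p) m                    ∎) ⟫

  H-⋆ : ∀ {n} k c (p : Poly n) → H k (c ⋆P p) ≋ c ⋆P H k p
  H-⋆ k = ⋆-commute (H k) (λ m e a → ifDeg k e (δ m e a)) (coeff-H k)
    (λ m c e a → trans (ifDeg-cong k e (δ-* m e c a)) (ifDeg-* k e c _))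

  ⋆-*ˡ : ∀ {n} c (p q : Poly n) → (c ⋆P p) *P q ≋ c ⋆P (p *P q)
  ⋆-*ˡ c p q = ⋆-commute (_*P q) (productTerm q) (λ p m → coeff-* p q m)
    (λ m c e a → trans (termSum-ext (λ e′ b → trans (δ-cong m (e ⊕ e′) (*-assoc c a b)) (δ-* m (e ⊕ e′) c _)) q)
                       (sym (termSum-scale _ c q))) c p

  ⋆-*ʳ : ∀ {n} c (p q : Poly n) → p *P (c ⋆P q) ≋ c ⋆P (p *P q)
  ⋆-*ʳ c p q = ⟪ (λ m → begin
    coeff (p *P (c ⋆P q)) m             ≈⟨ coeff-* p (c ⋆P q) m ⟩
    termSum (productTerm (c ⋆P q) m) p  ≈⟨ termSum-ext (λ e a → scaled m e a) p ⟩
    termSum (λ e a → c * productTerm q m e a) p ≈⟨ sym (termSum-scale _ c p) ⟩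
    c * termSum (productTerm q m) p     ≈⟨ *-congˡ (sym (coeff-* p q m)) ⟩
    c * coeff (p *P q) m                ≈⟨ sym (coeff-⋆ c (p *P q) m) ⟩
    coeff (c ⋆P (p *P q)) m             ∎) ⟫
    where
    scaled : ∀ m e a → productTerm (c ⋆P q) m e a ≈ c * productTerm q m e a
    scaled m e a = trans (reflexive (termSum-⋆ _ c q))
      (trans (termSum-ext (λ e′ b → trans (δ-cong m (e ⊕ e′) (*-Props.x∙yz≈y∙xz a c b)) (δ-* m (e ⊕ e′) c _)) q)
             (sym (termSum-scale _ c q)))

  *-++ˡ : ∀ {n} (p p′ q : Poly n) → (p ++ p′) *P q ≡ (p *P q) ++ (p′ *P q)
  *-++ˡ p p′ q = ListP.concatMap-++ _ p p′

  *-++ʳ : ∀ {n} (p q q′ : Poly n) → p *P (q ++ q′) ≋ (p *P q) ++ (p *P q′)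
  *-++ʳ p q q′ = ⟪ (λ m → begin
    coeff (p *P (q ++ q′)) m                                     ≈⟨ coeff-* p (q ++ q′) m ⟩
    termSum (productTerm (q ++ q′) m) p                          ≈⟨ termSum-ext (λ e a → termSum-++ _ q q′) p ⟩
    termSum (λ e a → productTerm q m e a + productTerm q′ m e a) p ≈⟨ termSum-+ _ _ p ⟩
    termSum (productTerm q m) p + termSum (productTerm q′ m) p   ≈⟨ sym (+-cong (coeff-* p q m) (coeff-* p q′ m)) ⟩
    coeff (p *P q) m + coeff (p *P q′) m                         ≈⟨ sym (coeff-++ (p *P q) _ m) ⟩
    coeff ((p *P q) ++ (p *P q′)) m                              ∎) ⟫

  *-zeroʳ : ∀ {n} (p : Poly n) → p *P [] ≋ []
  *-zeroʳ p = ⟪ (λ m → trans (coeff-* p [] m) (termSum-0 (λ e a → refl) p)) ⟫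

  ∂Term : ∀ {n} → Fin n → Monomial n → TermMap n
  ∂Term i m e a = δ m (decAt i e) (lookup e i · a)

  termSum-∂ : ∀ {n} (G : TermMap n) i (p : Poly n) →
    termSum G (∂ i p) ≡ termSum (λ e a → G (decAt i e) (lookup e i · a)) p
  termSum-∂ G i p = termSum-map G (λ t → lookup (proj₂ t) i · proj₁ t , decAt i (proj₂ t)) p

  coeff-∂ : ∀ {n} i (p : Poly n) m → coeff (∂ i p) m ≈ termSum (∂Term i m) p
  coeff-∂ i p m = trans (coeff-termSum (∂ i p) m) (reflexive (termSum-∂ (δ m) i p))

  ∂-cong : ∀ {n} i {p q : Poly n} → p ≋ q → ∂ i p ≋ ∂ i q
  ∂-cong i {p} {q} h = ⟪ (λ m → trans (coeff-∂ i p m)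
    (trans (termSum-cong (δ-additive m (decAt i) (multiple-additive (λ e → lookup e i))) h) (sym (coeff-∂ i q m)))) ⟫

  ∂-++ : ∀ {n} i (p q : Poly n) → ∂ i (p ++ q) ≡ ∂ i p ++ ∂ i q
  ∂-++ i p q = ListP.map-++ _ p q

  ∂-⋆ : ∀ {n} i c (p : Poly n) → ∂ i (c ⋆P p) ≋ c ⋆P ∂ i p
  ∂-⋆ i = ⋆-commute (∂ i) (∂Term i) (coeff-∂ i)
    (λ m c e a → trans (δ-cong m (decAt i e) (·-comm-* (lookup e i) c a)) (δ-* m (decAt i e) c _))

  -- One term of the Leibniz rule, by cases on the exponents u, v of xᵢ in
  -- the two factors: (u+v)·ab at xᵉ⁺ᵉ′⁻¹ splits as (u·a)b + a(v·b).
  leibniz-term : ∀ {n} (i : Fin n) m (e e′ : Monomial n) a b u v → lookup e i ≡ u → lookup e′ i ≡ v →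
    δ m (decAt i (e ⊕ e′)) ((u ℕ.+ v) · (a * b))
      ≈ δ m (decAt i e ⊕ e′) ((u · a) * b) + δ m (e ⊕ decAt i e′) (a * (v · b))
  leibniz-term i m e e′ a b zero zero eu ev = begin
    δ m (decAt i (e ⊕ e′)) 0#   ≈⟨ δ-0 m (decAt i (e ⊕ e′)) ⟩
    0#                          ≈⟨ sym (+-identityˡ 0#) ⟩
    0# + 0#                     ≈⟨ sym (+-cong (δ-≈0 m (decAt i e ⊕ e′) (zeroˡ b)) (δ-≈0 m (e ⊕ decAt i e′) (zeroʳ a))) ⟩
    _                           ∎
  leibniz-term i m e e′ a b zero (suc y) eu ev = begin
    δ m (decAt i (e ⊕ e′)) (suc y · (a * b))  ≡⟨ ≡.cong (λ M → δ m M (suc y · (a * b))) (Exponents.lower-⊕ʳ e e′ i ev) ⟩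
    δ m (e ⊕ decAt i e′) (suc y · (a * b))    ≈⟨ δ-cong m (e ⊕ decAt i e′) (·-comm-* (suc y) a b) ⟩
    δ m (e ⊕ decAt i e′) (a * (suc y · b))    ≈⟨ sym (+-identityˡ _) ⟩
    0# + _                                    ≈⟨ +-congʳ (sym (δ-≈0 m (decAt i e ⊕ e′) (zeroˡ b))) ⟩
    _                                         ∎
  leibniz-term i m e e′ a b (suc x) zero eu ev = begin
    δ m (decAt i (e ⊕ e′)) ((suc x ℕ.+ 0) · (a * b))
      ≡⟨ ≡.cong₂ (λ M k → δ m M (k · (a * b))) (Exponents.lower-⊕ˡ e e′ i eu) (ℕP.+-identityʳ (suc x)) ⟩
    δ m (decAt i e ⊕ e′) (suc x · (a * b))    ≈⟨ δ-cong m (decAt i e ⊕ e′) (·-assoc-* (suc x) a b) ⟩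
    δ m (decAt i e ⊕ e′) ((suc x · a) * b)    ≈⟨ sym (+-identityʳ _) ⟩
    _ + 0#                                    ≈⟨ +-congˡ (sym (δ-≈0 m (e ⊕ decAt i e′) (zeroʳ a))) ⟩
    _                                         ∎
  leibniz-term i m e e′ a b (suc x) (suc y) eu ev = begin
    δ m E ((suc x ℕ.+ suc y) · (a * b))               ≈⟨ δ-cong m E (·-homo-+ (suc x) (suc y) _) ⟩
    δ m E (suc x · (a * b) + suc y · (a * b))         ≈⟨ δ-+ m E _ _ ⟩
    δ m E (suc x · (a * b)) + δ m E (suc y · (a * b)) ≈⟨ +-cong (δ-cong m E (·-assoc-* (suc x) a b)) (δ-cong m E (·-comm-* (suc y) a b)) ⟩
    δ m E ((suc x · a) * b) + δ m E (a * (suc y · b))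
      ≡⟨ ≡.cong₂ (λ M M′ → δ m M ((suc x · a) * b) + δ m M′ (a * (suc y · b)))
                 (Exponents.lower-⊕ˡ e e′ i eu) (Exponents.lower-⊕ʳ e e′ i ev) ⟩
    _                                                 ∎
    where
    E = decAt i (e ⊕ e′)

  ∂-leibniz : ∀ {n} (i : Fin n) (p q : Poly n) → ∂ i (p *P q) ≋ (∂ i p *P q) ++ (p *P ∂ i q)
  ∂-leibniz i p q = ⟪ (λ m → begin
    coeff (∂ i (p *P q)) m
      ≈⟨ trans (coeff-∂ i (p *P q) m) (termSum-* (∂Term i m) p q) ⟩
    termSum (λ e a → termSum (λ e′ b → ∂Term i m (e ⊕ e′) (a * b)) q) p
      ≈⟨ termSum-ext (λ e a → termSum-ext (λ e′ b → split m e e′ a b) q) p ⟩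
    termSum (λ e a → termSum (λ e′ b → δ m (decAt i e ⊕ e′) ((lookup e i · a) * b)
                                        + δ m (e ⊕ decAt i e′) (a * (lookup e′ i · b))) q) p
      ≈⟨ trans (termSum-ext (λ e a → termSum-+ _ _ q) p) (termSum-+ _ _ p) ⟩
    termSum (λ e a → productTerm q m (decAt i e) (lookup e i · a)) p
      + termSum (λ e a → termSum (λ e′ b → δ m (e ⊕ decAt i e′) (a * (lookup e′ i · b))) q) p
      ≈⟨ sym (+-cong (reflexive (termSum-∂ (productTerm q m) i p)) (termSum-ext (λ e a → reflexive (termSum-∂ _ i q)) p)) ⟩
    termSum (productTerm q m) (∂ i p) + termSum (productTerm (∂ i q) m) p
      ≈⟨ sym (+-cong (coeff-* (∂ i p) q m) (coeff-* p (∂ i q) m)) ⟩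
    coeff (∂ i p *P q) m + coeff (p *P ∂ i q) m
      ≈⟨ sym (coeff-++ (∂ i p *P q) _ m) ⟩
    coeff ((∂ i p *P q) ++ (p *P ∂ i q)) m ∎) ⟫
    where
    split : ∀ m e e′ a b → ∂Term i m (e ⊕ e′) (a * b)
      ≈ δ m (decAt i e ⊕ e′) ((lookup e i · a) * b) + δ m (e ⊕ decAt i e′) (a * (lookup e′ i · b))
    split m e e′ a b = trans (δ-cong m (decAt i (e ⊕ e′)) (reflexive (≡.cong (_· (a * b)) (lookup-zipWith ℕ._+_ i e e′))))
                             (leibniz-term i m e e′ a b _ _ ≡.refl ≡.refl)

  ∂-H-suc : ∀ {n} (i : Fin n) k (p : Poly n) → ∂ i (H (suc k) p) ≋ H k (∂ i p)
  ∂-H-suc i k p = ⟪ (λ m → begin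
    coeff (∂ i (H (suc k) p)) m                                 ≈⟨ coeff-∂ i (H (suc k) p) m ⟩
    termSum (∂Term i m) (H (suc k) p)                           ≈⟨ termSum-H (∂Term i m) (suc k) p ⟩
    termSum (λ e a → ifDeg (suc k) e (∂Term i m e a)) p         ≈⟨ termSum-ext (λ e a → shift m e a _ ≡.refl) p ⟩
    termSum (λ e a → ifDeg k (decAt i e) (∂Term i m e a)) p     ≡⟨ ≡.sym (termSum-∂ _ i p) ⟩
    termSum (λ e a → ifDeg k e (δ m e a)) (∂ i p)               ≈⟨ sym (coeff-H k (∂ i p) m) ⟩
    coeff (H k (∂ i p)) m                                       ∎) ⟫
    where
    shift : ∀ m e a u → lookup e i ≡ u →
      ifDeg (suc k) e (δ m (decAt i e) (u · a)) ≈ ifDeg k (decAt i e) (δ m (decAt i e) (u · a))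
    shift m e a zero    _  = trans (ifDeg-cong (suc k) e (δ-0 m (decAt i e)))
      (trans (ifDeg-0 (suc k) e) (sym (trans (ifDeg-cong k (decAt i e) (δ-0 m (decAt i e))) (ifDeg-0 k (decAt i e)))))
    shift m e a (suc x) eq =
      reflexive (≡.cong (λ z → if z ℕ.≡ᵇ suc k then δ m (decAt i e) (suc x · a) else 0#) (Exponents.deg-lower e i eq))

  ∂-H-0 : ∀ {n} (i : Fin n) (p : Poly n) → ∂ i (H 0 p) ≋ []
  ∂-H-0 i p = ⟪ (λ m → begin
    coeff (∂ i (H 0 p)) m                          ≈⟨ coeff-∂ i (H 0 p) m ⟩
    termSum (∂Term i m) (H 0 p)                    ≈⟨ termSum-H (∂Term i m) 0 p ⟩
    termSum (λ e a → ifDeg 0 e (∂Term i m e a)) p  ≈⟨ termSum-0 (λ e a → vanish m e a _ ≡.refl) p ⟩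
    0#                                             ∎) ⟫
    where
    vanish : ∀ m e a u → lookup e i ≡ u → ifDeg 0 e (δ m (decAt i e) (u · a)) ≈ 0#
    vanish m e a zero    _  = trans (ifDeg-cong 0 e (δ-0 m (decAt i e))) (ifDeg-0 0 e)
    vanish m e a (suc x) eq =
      reflexive (≡.cong (λ z → if z ℕ.≡ᵇ 0 then δ m (decAt i e) (suc x · a) else 0#) (Exponents.deg-lower e i eq))

  sumTo : ∀ {n} → ℕ → (ℕ → Poly n) → Poly n
  sumTo zero    G = G 0
  sumTo (suc k) G = sumTo k G ++ G (suc k)

  Σ≤ : ℕ → (ℕ → Carrier) → Carrier
  Σ≤ zero    g = g 0
  Σ≤ (suc k) g = Σ≤ k g + g (suc k)

  Σ≤-cong : ∀ k {g g′} → (∀ j → g j ≈ g′ j) → Σ≤ k g ≈ Σ≤ k g′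
  Σ≤-cong zero    h = h 0
  Σ≤-cong (suc k) h = +-cong (Σ≤-cong k h) (h (suc k))

  coeff-sumTo : ∀ {n} k (G : ℕ → Poly n) m → coeff (sumTo k G) m ≈ Σ≤ k (λ j → coeff (G j) m)
  coeff-sumTo zero    G m = refl
  coeff-sumTo (suc k) G m = trans (coeff-++ (sumTo k G) (G (suc k)) m) (+-congʳ (coeff-sumTo k G m))

  Σ≤-termSum : ∀ {n} k (G : ℕ → TermMap n) p → Σ≤ k (λ j → termSum (G j) p) ≈ termSum (λ e a → Σ≤ k (λ j → G j e a)) p
  Σ≤-termSum zero    G p = refl
  Σ≤-termSum (suc k) G p = trans (+-congʳ (Σ≤-termSum k G p)) (sym (termSum-+ _ _ p))

  Σ≤-indicator : ∀ k u (y : ℕ → Carrier) →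
    Σ≤ k (λ j → if u ℕ.≡ᵇ j then y j else 0#) ≈ (if DegreeTests.atMost u k then y u else 0#)
  Σ≤-indicator zero zero    y = refl
  Σ≤-indicator zero (suc u) y = refl
  Σ≤-indicator (suc k) u y with u ℕ.≡ᵇ suc k in eq
  ... | true rewrite DegreeTests.≡ᵇ-true⇒≡ u (suc k) eq | DegreeTests.atMost-refl k =
    trans (+-congʳ (trans (Σ≤-indicator k (suc k) y)
                          (reflexive (≡.cong (λ b → if b then y (suc k) else 0#) (DegreeTests.atMost-suc k)))))
          (+-identityˡ _)
  ... | false rewrite DegreeTests.atMost-step u k eq = trans (+-congʳ (Σ≤-indicator k u y)) (+-identityʳ _)

  -- the degree bookkeeping behind H-*: a product term xᵉ⁺ᵉ′ is counted once
  Σ≤-ifDeg : ∀ {n} k (e e′ : Monomial n) x →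
    Σ≤ k (λ j → ifDeg j e (ifDeg (k ∸ j) e′ x)) ≈ ifDeg k (e ⊕ e′) x
  Σ≤-ifDeg k e e′ x = begin
    Σ≤ k (λ j → ifDeg j e (ifDeg (k ∸ j) e′ x))
      ≈⟨ Σ≤-indicator k (totalDegree e) (λ j → ifDeg (k ∸ j) e′ x) ⟩
    (if DegreeTests.atMost (totalDegree e) k then ifDeg (k ∸ totalDegree e) e′ x else 0#)
      ≡⟨ DegreeTests.choose-diagonal x 0# (totalDegree e) (totalDegree e′) k ⟩
    (if totalDegree e ℕ.+ totalDegree e′ ℕ.≡ᵇ k then x else 0#)
      ≡⟨ ≡.cong (λ z → if z ℕ.≡ᵇ k then x else 0#) (≡.sym (Exponents.deg-⊕ e e′)) ⟩
    ifDeg k (e ⊕ e′) x ∎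

  H-* : ∀ {n} k (p q : Poly n) → H k (p *P q) ≋ sumTo k (λ j → H j p *P H (k ∸ j) q)
  H-* {n} k p q = ⟪ (λ m → begin
    coeff (H k (p *P q)) m
      ≈⟨ trans (coeff-H k (p *P q) m) (termSum-* _ p q) ⟩
    termSum (λ e a → termSum (λ e′ b → ifDeg k (e ⊕ e′) (δ m (e ⊕ e′) (a * b))) q) p
      ≈⟨ termSum-ext (λ e a → termSum-ext (λ e′ b → sym (Σ≤-ifDeg k e e′ _)) q) p ⟩
    termSum (λ e a → termSum (λ e′ b → Σ≤ k (λ j → T m j e a e′ b)) q) p
      ≈⟨ trans (termSum-ext (λ e a → sym (Σ≤-termSum k _ q)) p) (sym (Σ≤-termSum k _ p)) ⟩
    Σ≤ k (λ j → termSum (λ e a → termSum (T m j e a) q) p)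
      ≈⟨ Σ≤-cong k (λ j → sym (coeff-component m j)) ⟩
    Σ≤ k (λ j → coeff (H j p *P H (k ∸ j) q) m)
      ≈⟨ sym (coeff-sumTo k _ m) ⟩
    coeff (sumTo k (λ j → H j p *P H (k ∸ j) q)) m ∎) ⟫
    where
    T : Monomial n → ℕ → Monomial n → Carrier → Monomial n → Carrier → Carrier
    T m j e a e′ b = ifDeg j e (ifDeg (k ∸ j) e′ (δ m (e ⊕ e′) (a * b)))

    coeff-component : ∀ m j → coeff (H j p *P H (k ∸ j) q) m ≈ termSum (λ e a → termSum (T m j e a) q) p
    coeff-component m j = begin
      coeff (H j p *P H (k ∸ j) q) m
        ≈⟨ coeff-* (H j p) (H (k ∸ j) q) m ⟩
      termSum (productTerm (H (k ∸ j) q) m) (H j p)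
        ≈⟨ termSum-H (productTerm (H (k ∸ j) q) m) j p ⟩
      termSum (λ e a → ifDeg j e (productTerm (H (k ∸ j) q) m e a)) p
        ≈⟨ termSum-ext (λ e a → ifDeg-cong j e (termSum-H (λ e′ b → δ m (e ⊕ e′) (a * b)) (k ∸ j) q)) p ⟩
      termSum (λ e a → ifDeg j e (termSum (λ e′ b → ifDeg (k ∸ j) e′ (δ m (e ⊕ e′) (a * b))) q)) p
        ≈⟨ termSum-ext (λ e a → ifDeg-termSum j e _ q) p ⟩
      termSum (λ e a → termSum (T m j e a) q) p ∎

  -- (a record, so that the polynomial can be inferred from a proof)
  record HomDeg {n} (k : ℕ) (p : Poly n) : Set ℓ where
    constructor homDeg
    field vanishes : ∀ m → totalDegree m ≢ k → coeff p m ≈ 0#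
  open HomDeg public

  isHomogeneous : ∀ {n k} {p : Poly n} → HomDeg k p → IsHomogeneous p
  isHomogeneous {k = k} h = k , vanishes h

  HomDeg-H : ∀ {n} k (p : Poly n) → HomDeg k (H k p)
  HomDeg-H k p = homDeg (λ m deg≢k → trans (coeff-H k p m) (termSum-0 (vanish m deg≢k) p))
    where
    vanish : ∀ m → totalDegree m ≢ k → ∀ e a → ifDeg k e (δ m e a) ≈ 0#
    vanish m deg≢k e a with e ≟M m
    ... | yes ≡.refl = reflexive (≡.cong (λ b → if b then a else 0#) (DegreeTests.≢⇒≡ᵇ-false _ _ deg≢k))
    ... | no _       = ifDeg-0 k e

  HomDeg-cong : ∀ {n} {k} {p q : Poly n} → p ≋ q → HomDeg k p → HomDeg k q
  HomDeg-cong p≋q hp = homDeg (λ m deg≢k → trans (sym (at p≋q m)) (vanishes hp m deg≢k))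

  HomDeg-++ : ∀ {n} {k} {p q : Poly n} → HomDeg k p → HomDeg k q → HomDeg k (p ++ q)
  HomDeg-++ {p = p} {q} hp hq = homDeg (λ m deg≢k →
    trans (coeff-++ p q m) (trans (+-cong (vanishes hp m deg≢k) (vanishes hq m deg≢k)) (+-identityˡ 0#)))

  HomDeg-[] : ∀ {n} k → HomDeg {n} k []
  HomDeg-[] k = homDeg (λ m _ → refl)

  HomDeg-* : ∀ {n} {i j} {p q : Poly n} → HomDeg i p → HomDeg j q → HomDeg (i ℕ.+ j) (p *P q)
  HomDeg-* {n} {i} {j} {p} {q} hp hq = homDeg (λ m deg≢i+j →
    trans (coeff-* p q m) (termSum-vanishes (productTerm-additive q m) p (outer m deg≢i+j)))
    where
    outer : ∀ m → totalDegree m ≢ i ℕ.+ j → ∀ e → productTerm q m e (coeff p e) ≈ 0#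
    outer m deg≢i+j e with totalDegree e ℕ.≟ i
    ... | no  de≢i = trans (resp-≈ (productTerm-additive q m) e (vanishes hp e de≢i)) (hom-0 (productTerm-additive q m) e)
    ... | yes de≡i = termSum-vanishes (δ-additive m (e ⊕_) (scaleˡ-additive (coeff p e))) q inner
      where
      inner : ∀ e′ → δ m (e ⊕ e′) (coeff p e * coeff q e′) ≈ 0#
      inner e′ with totalDegree e′ ℕ.≟ j
      ... | no  de′≢j = δ-≈0 m (e ⊕ e′) (trans (*-congˡ (vanishes hq e′ de′≢j)) (zeroʳ _))
      ... | yes de′≡j = δ-≢ m (e ⊕ e′) _ (λ eq → deg≢i+j (≡.trans (≡.cong totalDegree (≡.sym eq))
                           (≡.trans (Exponents.deg-⊕ e e′) (≡.cong₂ ℕ._+_ de≡i de′≡j))))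

  HomDeg-const : ∀ {n} a → HomDeg {n} 0 (constP a)
  HomDeg-const {n} a = homDeg vanish
    where
    vanish : ∀ m → totalDegree m ≢ 0 → coeff (constP a) m ≈ 0#
    vanish m deg≢0 with Vec.replicate n 0 ≟M m
    ... | yes ≡.refl = ⊥-elim (deg≢0 (Exponents.deg-replicate0 n))
    ... | no _       = refl

  deg-unitVec : ∀ {n} (i : Fin n) → totalDegree (unitVec i) ≡ 1
  deg-unitVec {suc n} Fin.zero    = ≡.cong suc (Exponents.deg-replicate0 n)
  deg-unitVec {suc n} (Fin.suc i) = deg-unitVec i

  HomDeg-var : ∀ {n} (i : Fin n) → HomDeg 1 (varP i)
  HomDeg-var i = homDeg vanish
    where
    vanish : ∀ m → totalDegree m ≢ 1 → coeff (varP i) m ≈ 0#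
    vanish m deg≢1 with unitVec i ≟M m
    ... | yes ≡.refl = ⊥-elim (deg≢1 (deg-unitVec i))
    ... | no _       = refl

  coeff-H-same : ∀ {n} k (p : Poly n) m → totalDegree m ≡ k → coeff (H k p) m ≈ coeff p m
  coeff-H-same k p m deg≡k = trans (coeff-H k p m) (trans (termSum-ext keep p) (sym (coeff-termSum p m)))
    where
    keep : ∀ e a → ifDeg k e (δ m e a) ≈ δ m e a
    keep e a with e ≟M m
    ... | yes ≡.refl = reflexive (≡.trans (≡.cong (λ z → if z ℕ.≡ᵇ k then a else 0#) deg≡k)
                                          (≡.cong (λ b → if b then a else 0#) (DegreeTests.≡ᵇ-refl k)))
    ... | no _       = ifDeg-0 k e

  H-homogeneous : ∀ {n} k {p : Poly n} → HomDeg k p → H k p ≋ p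
  H-homogeneous k {p} hp = ⟪ coefficient ⟫
    where
    coefficient : ∀ m → coeff (H k p) m ≈ coeff p m
    coefficient m with totalDegree m ℕ.≟ k
    ... | yes deg≡k = coeff-H-same k p m deg≡k
    ... | no  deg≢k = trans (vanishes (HomDeg-H k p) m deg≢k) (sym (vanishes hp m deg≢k))

  H-other : ∀ {n} j k {p : Poly n} → HomDeg k p → j ≢ k → H j p ≋ []
  H-other j k {p} hp j≢k = ⟪ coefficient ⟫
    where
    coefficient : ∀ m → coeff (H j p) m ≈ 0#
    coefficient m with totalDegree m ℕ.≟ j
    ... | yes deg≡j = trans (coeff-H-same j p m deg≡j) (vanishes hp m (λ deg≡k → j≢k (≡.trans (≡.sym deg≡j) deg≡k)))
    ... | no  deg≢j = vanishes (HomDeg-H j p) m deg≢j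

  module _ {n : ℕ} {A : Set} where

    sumP-cong : ∀ (xs : List A) {f g : A → Poly n} → (∀ x → f x ≋ g x) → sumP (List.map f xs) ≋ sumP (List.map g xs)
    sumP-cong []       h = ≋-refl
    sumP-cong (x ∷ xs) h = ++-cong (h x) (sumP-cong xs h)

    sumP-zero : ∀ (xs : List A) {f : A → Poly n} → (∀ x → f x ≋ []) → sumP (List.map f xs) ≋ []
    sumP-zero []       h = ≋-refl
    sumP-zero (x ∷ xs) h = ++-cong (h x) (sumP-zero xs h)

    sumP-++ : ∀ (xs : List A) (f g : A → Poly n) →
      sumP (List.map (λ x → f x ++ g x) xs) ≋ sumP (List.map f xs) ++ sumP (List.map g xs)
    sumP-++ []       f g = ≋-refl
    sumP-++ (x ∷ xs) f g = ≋-trans (++-cong ≋-refl (sumP-++ xs f g)) (++-interchange (f x) (g x) _ _)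

    *-sumPˡ : ∀ (xs : List A) (f : A → Poly n) q → sumP (List.map f xs) *P q ≡ sumP (List.map (λ x → f x *P q) xs)
    *-sumPˡ []       f q = ≡.refl
    *-sumPˡ (x ∷ xs) f q = ≡.trans (*-++ˡ (f x) _ q) (≡.cong ((f x *P q) ++_) (*-sumPˡ xs f q))

    *-sumPʳ : ∀ (xs : List A) (f : A → Poly n) p → p *P sumP (List.map f xs) ≋ sumP (List.map (λ x → p *P f x) xs)
    *-sumPʳ []       f p = *-zeroʳ p
    *-sumPʳ (x ∷ xs) f p = ≋-trans (*-++ʳ p (f x) _) (++-cong ≋-refl (*-sumPʳ xs f p))

  module _ {n : ℕ} where

    sumP-map : ∀ (T : Poly n → Poly n) → (∀ p q → T (p ++ q) ≡ T p ++ T q) → T [] ≡ [] →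
      ∀ ps → T (sumP ps) ≡ sumP (List.map T ps)
    sumP-map T T-++ T-[] []       = T-[]
    sumP-map T T-++ T-[] (p ∷ ps) = ≡.trans (T-++ p (sumP ps)) (≡.cong (T p ++_) (sumP-map T T-++ T-[] ps))

    sumP-append : ∀ (ps qs : List (Poly n)) → sumP (ps ++ qs) ≋ sumP ps ++ sumP qs
    sumP-append []       qs = ≋-refl
    sumP-append (p ∷ ps) qs = ≋-trans (++-cong ≋-refl (sumP-append ps qs)) (≋-reflexive (≡.sym (ListP.++-assoc p (sumP ps) (sumP qs))))

  sumP-concatMap : ∀ {n} {A B : Set} (f : B → Poly n) (g : A → List B) (xs : List A) →
    sumP (List.map f (List.concatMap g xs)) ≋ sumP (List.map (λ x → sumP (List.map f (g x))) xs)
  sumP-concatMap f g []       = ≋-refl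
  sumP-concatMap f g (x ∷ xs) =
    ≋-trans (≋-reflexive (≡.cong sumP (ListP.map-++ f (g x) _)))
    (≋-trans (sumP-append (List.map f (g x)) _) (++-cong ≋-refl (sumP-concatMap f g xs)))

  sumP-single : ∀ {N} n (f : Fin n → Poly N) j → (∀ i → i ≢ j → f i ≋ []) → sumP (List.map f (allFin n)) ≋ f j
  sumP-single (suc n) f Fin.zero h =
    ≋-trans (++-cong ≋-refl
      (≋-trans (≋-reflexive (≡.cong sumP (≡.sym (ListP.map-∘ (allFin n)))))
               (sumP-zero (allFin n) (λ i → h (Fin.suc i) (λ ())))))
    (≋-reflexive (ListP.++-identityʳ (f Fin.zero)))
  sumP-single (suc n) f (Fin.suc j) h =
    ≋-trans (++-cong (h Fin.zero (λ ())) ≋-refl)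
    (≋-trans (≋-reflexive (≡.cong sumP (≡.sym (ListP.map-∘ (allFin n)))))
    (sumP-single n (f ∘ Fin.suc) j (λ i i≢j → h (Fin.suc i) (λ eq → i≢j (FinP.suc-injective eq)))))

  lookup-unitVec-same : ∀ {n} (j : Fin n) → lookup (unitVec j) j ≡ 1
  lookup-unitVec-same {suc n} Fin.zero    = ≡.refl
  lookup-unitVec-same {suc n} (Fin.suc j) = lookup-unitVec-same j

  lookup-unitVec-other : ∀ {n} (i j : Fin n) → i ≢ j → lookup (unitVec j) i ≡ 0
  lookup-unitVec-other {suc n} Fin.zero    Fin.zero    i≢j = ⊥-elim (i≢j ≡.refl)
  lookup-unitVec-other {suc n} Fin.zero    (Fin.suc j) i≢j = ≡.refl
  lookup-unitVec-other {suc n} (Fin.suc i) Fin.zero    i≢j = lookup-replicate i 0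
  lookup-unitVec-other {suc n} (Fin.suc i) (Fin.suc j) i≢j = lookup-unitVec-other i j (λ eq → i≢j (≡.cong Fin.suc eq))

  decAt-unitVec : ∀ {n} (j : Fin n) → decAt j (unitVec j) ≡ Vec.replicate n 0
  decAt-unitVec {suc n} Fin.zero    = ≡.refl
  decAt-unitVec {suc n} (Fin.suc j) = ≡.cong (0 ∷_) (decAt-unitVec j)

module DirectionalDerivative {c ℓ : Level} (F : Field c ℓ) {n : ℕ} (a : Vec (Field.Carrier F) n) where
  open Field F
  open FieldDefs F
  open PolynomialAlgebra F
  open import Relation.Binary.Reasoning.Setoid (≋-setoid n)

  D : Poly n → Poly n
  D p = sumP (List.map (λ i → lookup a i ⋆P ∂ i p) (allFin n))

  iterD : ℕ → Poly n → Poly n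
  iterD zero    p = p
  iterD (suc r) p = D (iterD r p)

  iterD-suc : ∀ r p → iterD (suc r) p ≡ iterD r (D p)
  iterD-suc zero    p = ≡.refl
  iterD-suc (suc r) p = ≡.cong D (iterD-suc r p)

  iterD-+ : ∀ x y p → iterD (x ℕ.+ y) p ≡ iterD x (iterD y p)
  iterD-+ zero    y p = ≡.refl
  iterD-+ (suc x) y p = ≡.cong D (iterD-+ x y p)

  D-cong : ∀ {p q} → p ≋ q → D p ≋ D q
  D-cong h = sumP-cong (allFin n) (λ i → ⋆-congʳ (lookup a i) (∂-cong i h))

  D-++ : ∀ p q → D (p ++ q) ≋ D p ++ D q
  D-++ p q = ≋-trans
    (sumP-cong (allFin n) (λ i → ≋-reflexive (≡.trans (≡.cong (lookup a i ⋆P_) (∂-++ i p q)) (⋆-++ (lookup a i) (∂ i p) (∂ i q)))))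
    (sumP-++ (allFin n) (λ i → lookup a i ⋆P ∂ i p) (λ i → lookup a i ⋆P ∂ i q))

  D-[] : D [] ≋ []
  D-[] = sumP-zero (allFin n) (λ i → ≋-refl)

  D-leibniz : ∀ p q → D (p *P q) ≋ (D p *P q) ++ (p *P D q)
  D-leibniz p q = ≋-trans (sumP-cong (allFin n) termwise)
    (≋-trans (sumP-++ (allFin n) (λ i → (lookup a i ⋆P ∂ i p) *P q) (λ i → p *P (lookup a i ⋆P ∂ i q)))
             (++-cong (≋-reflexive (≡.sym (*-sumPˡ (allFin n) (λ i → lookup a i ⋆P ∂ i p) q)))
                      (≋-sym (*-sumPʳ (allFin n) (λ i → lookup a i ⋆P ∂ i q) p))))
    where
    termwise : ∀ i → lookup a i ⋆P ∂ i (p *P q) ≋ ((lookup a i ⋆P ∂ i p) *P q) ++ (p *P (lookup a i ⋆P ∂ i q))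
    termwise i = ≋-trans (⋆-congʳ (lookup a i) (∂-leibniz i p q))
      (≋-trans (≋-reflexive (⋆-++ (lookup a i) (∂ i p *P q) (p *P ∂ i q)))
               (++-cong (≋-sym (⋆-*ˡ (lookup a i) (∂ i p) q)) (≋-sym (⋆-*ʳ (lookup a i) p (∂ i q)))))

  D-H-suc : ∀ k p → D (H (suc k) p) ≋ H k (D p)
  D-H-suc k p = ≋-trans
    (sumP-cong (allFin n) (λ i → ≋-trans (⋆-congʳ (lookup a i) (∂-H-suc i k p)) (≋-sym (H-⋆ k (lookup a i) (∂ i p)))))
    (≋-reflexive (≡.trans (≡.cong sumP (ListP.map-∘ (allFin n)))
                          (≡.sym (sumP-map (H k) (H-++ k) ≡.refl (List.map (λ i → lookup a i ⋆P ∂ i p) (allFin n))))))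

  D-H-0 : ∀ p → D (H 0 p) ≋ []
  D-H-0 p = sumP-zero (allFin n) (λ i → ⋆-congʳ (lookup a i) (∂-H-0 i p))

  D-var : ∀ j → D (varP j) ≋ constP (lookup a j)
  D-var j = ≋-trans
    (sumP-single n (λ i → lookup a i ⋆P ∂ i (varP j)) j
      (λ i i≢j → single-zero _ _ (trans (*-congˡ (reflexive (≡.cong (_· 1#) (lookup-unitVec-other i j i≢j)))) (zeroʳ _))))
    (single-cong (trans (*-congˡ (trans (reflexive (≡.cong (_· 1#) (lookup-unitVec-same j))) (+-identityʳ 1#))) (*-identityʳ _))
                 (decAt-unitVec j))

  D-const : ∀ x → D (constP x) ≋ []
  D-const x = sumP-zero (allFin n) (λ i → single-zero _ _
    (trans (*-congˡ (reflexive (≡.cong (_· x) (lookup-replicate i 0)))) (zeroʳ _)))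

  iterD-cong : ∀ r {p q} → p ≋ q → iterD r p ≋ iterD r q
  iterD-cong zero    h = h
  iterD-cong (suc r) h = D-cong (iterD-cong r h)

  iterD-++ : ∀ r p q → iterD r (p ++ q) ≋ iterD r p ++ iterD r q
  iterD-++ zero    p q = ≋-refl
  iterD-++ (suc r) p q = ≋-trans (D-cong (iterD-++ r p q)) (D-++ _ _)

  iterD-zero : ∀ r {p} → p ≋ [] → iterD r p ≋ []
  iterD-zero zero    h = h
  iterD-zero (suc r) h = ≋-trans (D-cong (iterD-zero r h)) D-[]

  iterD-H : ∀ r t p → iterD r (H (r ℕ.+ t) p) ≋ H t (iterD r p)
  iterD-H zero    t p = ≋-refl
  iterD-H (suc r) t p = begin
    iterD (suc r) (H (suc r ℕ.+ t) p)  ≡⟨ iterD-suc r _ ⟩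
    iterD r (D (H (suc r ℕ.+ t) p))    ≈⟨ iterD-cong r (D-H-suc (r ℕ.+ t) p) ⟩
    iterD r (H (r ℕ.+ t) (D p))        ≈⟨ iterD-H r t (D p) ⟩
    H t (iterD r (D p))                ≡⟨ ≡.cong (H t) (≡.sym (iterD-suc r p)) ⟩
    H t (iterD (suc r) p)              ∎

  iterD-H-vanishes : ∀ k u p → iterD (u ℕ.+ suc k) (H k p) ≋ []
  iterD-H-vanishes k u p = begin
    iterD (u ℕ.+ suc k) (H k p)         ≡⟨ iterD-+ u (suc k) _ ⟩
    iterD u (D (iterD k (H k p)))       ≈⟨ iterD-cong u (D-cong lowered) ⟩
    iterD u (D (H 0 (iterD k p)))       ≈⟨ iterD-zero u (D-H-0 (iterD k p)) ⟩
    []                                  ∎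
    where
    lowered : iterD k (H k p) ≋ H 0 (iterD k p)
    lowered = ≋-trans (≋-reflexive (≡.cong (λ z → iterD k (H z p)) (≡.sym (ℕP.+-identityʳ k)))) (iterD-H k 0 p)

  tupleSum : ℕ → Poly n → Poly n
  tupleSum r g = sumP (List.map (λ e → prodAt a e ⋆P ∂s e g) (tuples n r))

  tupleSum-suc : ∀ r g → tupleSum (suc r) g ≋ D (tupleSum r g)
  tupleSum-suc r g = ≋-trans (sumP-concatMap _ (λ i → List.map (i ∷_) (tuples n r)) (allFin n))
    (sumP-cong (allFin n) (λ i →
      ≋-trans (≋-reflexive (≡.cong sumP (≡.sym (ListP.map-∘ (tuples n r)))))
      (≋-trans (sumP-cong (tuples n r) (λ e → ≋-sym (≋-trans (⋆-congʳ (lookup a i) (∂-⋆ i (prodAt a e) (∂s e g)))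
                                                             (⋆-⋆ (lookup a i) (prodAt a e) _))))
               (≋-reflexive (≡.sym (pushInside i))))))
    where
    Φ : Vec (Fin n) r → Poly n
    Φ e = prodAt a e ⋆P ∂s e g
    pushInside : ∀ i → lookup a i ⋆P ∂ i (tupleSum r g) ≡ sumP (List.map (λ e → lookup a i ⋆P ∂ i (Φ e)) (tuples n r))
    pushInside i = ≡.trans (≡.cong (lookup a i ⋆P_) (sumP-map (∂ i) (∂-++ i) ≡.refl (List.map Φ (tuples n r))))
      (≡.trans (sumP-map (lookup a i ⋆P_) (⋆-++ (lookup a i)) ≡.refl (List.map (∂ i) (List.map Φ (tuples n r))))
      (≡.cong sumP (≡.trans (≡.sym (ListP.map-∘ (List.map Φ (tuples n r)))) (≡.sym (ListP.map-∘ (tuples n r))))))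

  tupleSum-iterD : ∀ r g → tupleSum r g ≋ iterD r g
  tupleSum-iterD zero    g = ≋-trans (≋-reflexive (ListP.++-identityʳ _)) (⋆-identity g)
  tupleSum-iterD (suc r) g = ≋-trans (tupleSum-suc r g) (D-cong (tupleSum-iterD r g))

  fder-iterD : ∀ k r f → fder k r a f ≋ iterD r (H k f)
  fder-iterD k zero    f = ≋-refl
  fder-iterD k (suc r) f = tupleSum-iterD (suc r) (H k f)

  fder-lowered : ∀ {k r} f → r ≤ k → fder k r a f ≋ H (k ∸ r) (iterD r f)
  fder-lowered {k} {r} f r≤k = begin
    fder k r a f                 ≈⟨ fder-iterD k r f ⟩
    iterD r (H k f)              ≡⟨ ≡.cong (λ x → iterD r (H x f)) (≡.sym (ℕP.m+[n∸m]≡n r≤k)) ⟩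
    iterD r (H (r ℕ.+ (k ∸ r)) f) ≈⟨ iterD-H r (k ∸ r) f ⟩
    H (k ∸ r) (iterD r f)        ∎

  fder-vanishes : ∀ {k r} f → k < r → fder k r a f ≋ []
  fder-vanishes {k} {r} f k<r = begin
    fder k r a f                         ≈⟨ fder-iterD k r f ⟩
    iterD r (H k f)                      ≡⟨ ≡.cong (λ x → iterD x (H k f)) (≡.sym (ℕP.m∸n+n≡m k<r)) ⟩
    iterD (r ∸ suc k ℕ.+ suc k) (H k f)  ≈⟨ iterD-H-vanishes k (r ∸ suc k) f ⟩
    []                                   ∎

-- A partial construction is a
-- circuit all of whose gates are homogeneous; a build step appends gates,
-- keeps the old ones (so earlier results stay valid) and respects a bound
-- on the number of new gates.
module CircuitBuilding {c ℓ : Level} (F : Field c ℓ) {n : ℕ} where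
  open Field F
  open FieldDefs F
  open PolynomialAlgebra F

  record HCircuit : Set (c ⊔ ℓ) where
    constructor ⟨_,_⟩
    field
      {size}      : ℕ
      circuit     : Circuit n size
      homogeneous : IsHomogeneousCircuit circuit
  open HCircuit public

  poly : (S : HCircuit) → Fin (size S) → Poly n
  poly S = gatePoly (circuit S)

  record _⊑_ (S S′ : HCircuit) : Set c where
    field
      embed      : Fin (size S) → Fin (size S′)
      embed-poly : ∀ i → poly S′ (embed i) ≡ poly S i
  open _⊑_ public

  ⊑-refl : ∀ {S} → S ⊑ S
  ⊑-refl = record { embed = λ i → i ; embed-poly = λ i → ≡.refl }

  ⊑-trans : ∀ {S S′ S″} → S ⊑ S′ → S′ ⊑ S″ → S ⊑ S″
  ⊑-trans e e′ = record
    { embed = λ i → embed e′ (embed e i) ; embed-poly = λ i → ≡.trans (embed-poly e′ (embed e i)) (embed-poly e i) }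

  Monotone : ∀ {r} → (HCircuit → Set r) → Set (c ⊔ ℓ ⊔ r)
  Monotone R = ∀ {S S′} → S ⊑ S′ → R S → R S′

  record Produces (k : ℕ) (X : Poly n) (S : HCircuit) : Set (c ⊔ ℓ) where
    constructor produced
    field
      gate     : Fin (size S)
      computes : poly S gate ≋ X
      degree   : HomDeg k X
  open Produces public

  Produces-⊑ : ∀ {k X} → Monotone (Produces k X)
  Produces-⊑ e (produced g g≋X hX) = produced (embed e g) (≋-trans (≋-reflexive (embed-poly e g)) g≋X) hX

  recast : ∀ {k X Y S} → X ≋ Y → Produces k X S → Produces k Y S
  recast X≋Y (produced g g≋X hX) = produced g (≋-trans g≋X X≋Y) (HomDeg-cong X≋Y hX)

  regrade : ∀ {j k X S} → j ≡ k → Produces j X S → Produces k X S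
  regrade ≡.refl h = h

  record Build {r} (S : HCircuit) (b : ℕ) (R : HCircuit → Set r) : Set (c ⊔ ℓ ⊔ r) where
    constructor built
    field
      {result} : HCircuit
      extends  : S ⊑ result
      holds    : R result
      bound    : size result ≤ size S ℕ.+ b
  open Build public

  done : ∀ {r S b} {R : HCircuit → Set r} → R S → Build S b R
  done {S = S} {b} h = built ⊑-refl h (ℕP.m≤m+n (size S) b)

  relax : ∀ {r S b b′} {R : HCircuit → Set r} → b ≤ b′ → Build S b R → Build S b′ R
  relax b≤b′ (built e h bd) = built e h (ℕP.≤-trans bd (ℕP.+-monoʳ-≤ _ b≤b′))

  mapBuild : ∀ {r r′ S b} {R : HCircuit → Set r} {R′ : HCircuit → Set r′} →
    (∀ {S′} → S ⊑ S′ → R S′ → R′ S′) → Build S b R → Build S b R′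
  mapBuild f (built e h bd) = built e (f e h) bd

  _>>=_ : ∀ {r r′ S b b′} {R : HCircuit → Set r} {R′ : HCircuit → Set r′} → Build S b R →
    (∀ {S′} → S ⊑ S′ → R S′ → Build S′ b′ R′) → Build S (b ℕ.+ b′) R′
  _>>=_ {S = S} {b} {b′} (built e₁ h₁ bd₁) k with k e₁ h₁
  ... | built e₂ h₂ bd₂ = built (⊑-trans e₁ e₂) h₂
    (ℕP.≤-trans bd₂ (ℕP.≤-trans (ℕP.+-monoˡ-≤ b′ bd₁) (ℕP.≤-reflexive (ℕP.+-assoc (size S) b b′))))

  addGate : (S : HCircuit) (g : Gate n (size S)) → IsHomogeneous (gateSem g (evalAll (circuit S))) →
    Build S 1 (λ S′ → Σ (Fin (size S′)) λ i → poly S′ i ≡ gateSem g (evalAll (circuit S)))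
  addGate ⟨ C , homC ⟩ g homg = built {result = ⟨ C ▷ g , hom′ ⟩}
    (record { embed = Fin.suc ; embed-poly = λ i → ≡.refl }) (Fin.zero , ≡.refl) (ℕP.≤-reflexive (ℕP.+-comm 1 _))
    where
    hom′ : IsHomogeneousCircuit (C ▷ g)
    hom′ Fin.zero    = homg
    hom′ (Fin.suc i) = homC i

  addVar : ∀ S i → Build S 1 (Produces 1 (varP i))
  addVar S i = mapBuild (λ _ (g , eq) → produced g (≋-reflexive eq) (HomDeg-var i)) (addGate S (var i) (isHomogeneous (HomDeg-var i)))

  addConst : ∀ S x → Build S 1 (Produces 0 (constP x))
  addConst S x = mapBuild (λ _ (g , eq) → produced g (≋-reflexive eq) (HomDeg-const x)) (addGate S (const x) (isHomogeneous (HomDeg-const x)))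

  -- a zero polynomial is homogeneous of every degree; it is computed by the constant 0
  addZero : ∀ S k {X} → X ≋ [] → Build S 1 (Produces k X)
  addZero S k X≋0 = mapBuild
    (λ _ p → produced (gate p) (≋-trans (computes p) (≋-trans (single-zero 0# _ refl) (≋-sym X≋0)))
                   (HomDeg-cong (≋-sym X≋0) (HomDeg-[] k)))
    (addConst S 0#)

  addSum : ∀ {k X Y S} → Produces k X S → Produces k Y S → Build S 1 (Produces k (X ++ Y))
  addSum {S = S} (produced g gX hX) (produced h gY hY) = mapBuild
    (λ _ (i , eq) → produced i (≋-trans (≋-reflexive eq) (++-cong gX gY)) (HomDeg-++ hX hY))
    (addGate S (add g h) (isHomogeneous (HomDeg-cong (≋-sym (++-cong gX gY)) (HomDeg-++ hX hY))))

  addProduct : ∀ {j k X Y S} → Produces j X S → Produces k Y S → Build S 1 (Produces (j ℕ.+ k) (X *P Y))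
  addProduct {S = S} (produced g gX hX) (produced h gY hY) = mapBuild
    (λ _ (i , eq) → produced i (≋-trans (≋-reflexive eq) (*P-cong gX gY)) (HomDeg-* hX hY))
    (addGate S (mul g h) (isHomogeneous (HomDeg-cong (≋-sym (*P-cong gX gY)) (HomDeg-* hX hY))))

  forEach : ∀ {r} (S₀ : HCircuit) {b} {R : ℕ → HCircuit → Set r} → (∀ x → Monotone (R x)) →
    ∀ N → (∀ x → x ≤ N → ∀ {S} → S₀ ⊑ S → Build S b (R x)) →
    Build S₀ (suc N ℕ.* b) (λ S → ∀ x → x ≤ N → R x S)
  forEach S₀ {b} mono zero cell =
    relax (ℕP.≤-reflexive (≡.sym (ℕP.+-identityʳ b))) (mapBuild (λ _ h → λ { zero z≤n → h }) (cell 0 z≤n ⊑-refl))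
  forEach S₀ {b} {R} mono (suc N) cell =
    relax (ℕP.≤-reflexive (ℕP.+-comm (suc N ℕ.* b) b))
      (forEach S₀ mono N (λ x x≤N → cell x (ℕP.m≤n⇒m≤1+n x≤N)) >>= λ e earlier →
       mapBuild (λ e′ last → all e′ earlier last) (cell (suc N) ℕP.≤-refl e))
    where
    all : ∀ {S S′} → S ⊑ S′ → (∀ x → x ≤ N → R x S) → R (suc N) S′ → ∀ x → x ≤ suc N → R x S′
    all e′ earlier last x x≤ with ℕP.m≤n⇒m<n∨m≡n x≤
    ... | inj₁ (s≤s x≤N) = mono x e′ (earlier x x≤N)
    ... | inj₂ ≡.refl    = last

  forEach² : ∀ {r} (S₀ : HCircuit) {b} {R : ℕ → ℕ → HCircuit → Set r} → (∀ x y → Monotone (R x y)) →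
    ∀ N M → (∀ x y → x ≤ N → y ≤ M → ∀ {S} → S₀ ⊑ S → Build S b (R x y)) →
    Build S₀ (suc N ℕ.* (suc M ℕ.* b)) (λ S → ∀ x y → x ≤ N → y ≤ M → R x y S)
  forEach² S₀ mono N M cell = mapBuild (λ _ h x y x≤N y≤M → h x x≤N y y≤M)
    (forEach S₀ (λ x e h y y≤M → mono x y e (h y y≤M)) N
      (λ x x≤N {S} e → forEach S (mono x) M (λ y y≤M e′ → cell x y x≤N y≤M (⊑-trans e e′))))

  forEach³ : ∀ {r} (S₀ : HCircuit) {b} {R : ℕ → ℕ → ℕ → HCircuit → Set r} → (∀ x y z → Monotone (R x y z)) →
    ∀ N → (∀ x y z → x ≤ N → y ≤ N → z ≤ N → ∀ {S} → S₀ ⊑ S → Build S b (R x y z)) →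
    Build S₀ (suc N ℕ.* (suc N ℕ.* (suc N ℕ.* b))) (λ S → ∀ x y z → x ≤ N → y ≤ N → z ≤ N → R x y z S)
  forEach³ S₀ mono N cell = mapBuild (λ _ h x y z x≤N y≤N z≤N → h x x≤N y z y≤N z≤N)
    (forEach S₀ (λ x e h y z y≤N z≤N → mono x y z e (h y z y≤N z≤N)) N
      (λ x x≤N {S} e → forEach² S (mono x) N N (λ y z y≤N z≤N e′ → cell x y z x≤N y≤N z≤N (⊑-trans e e′))))

  stages : ∀ {r} (S₀ : HCircuit) {b₀ b} {R : ℕ → HCircuit → Set r} → (∀ m → Monotone (R m)) →
    Build S₀ b₀ (R 0) → (∀ m {S} → R m S → Build S b (R (suc m))) →
    ∀ N → Build S₀ (b₀ ℕ.+ N ℕ.* b) (λ S → ∀ m → m ≤ N → R m S)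
  stages S₀ {b₀} mono first next zero =
    relax (ℕP.m≤m+n b₀ 0) (mapBuild (λ _ h → λ { zero z≤n → h }) first)
  stages S₀ {b₀} {b} {R} mono first next (suc N) =
    relax (ℕP.≤-reflexive (reassociate b₀ (N ℕ.* b) b))
      (stages S₀ mono first next N >>= λ _ earlier →
       mapBuild (λ e last → all e earlier last) (next N (earlier N ℕP.≤-refl)))
    where
    reassociate : ∀ x y z → (x ℕ.+ y) ℕ.+ z ≡ x ℕ.+ (z ℕ.+ y)
    reassociate = solve-∀
    all : ∀ {S S′} → S ⊑ S′ → (∀ m → m ≤ N → R m S) → R (suc N) S′ → ∀ m → m ≤ suc N → R m S′
    all e earlier last m m≤ with ℕP.m≤n⇒m<n∨m≡n m≤
    ... | inj₁ (s≤s m≤N) = mono m e (earlier m m≤N)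
    ... | inj₂ ≡.refl    = last

module GateTables {c ℓ : Level} (F : Field c ℓ) {n : ℕ} (a : Vec (Field.Carrier F) n) (d : ℕ) where
  open Field F
  open FieldDefs F
  open PolynomialAlgebra F
  open DirectionalDerivative F a
  open CircuitBuilding F {n}
  open import Relation.Binary.Reasoning.Setoid (≋-setoid n)

  Table : Poly n → HCircuit → Set (c ⊔ ℓ)
  Table g S = ∀ r j → r ≤ d → j ≤ d → Produces j (H j (iterD r g)) S

  Table-⊑ : ∀ {g} → Monotone (Table g)
  Table-⊑ e t r j r≤d j≤d = Produces-⊑ e (t r j r≤d j≤d)

  tabulate : ∀ {g} S₀ → (∀ r j → r ≤ d → j ≤ d → ∀ {S} → S₀ ⊑ S → Build S 1 (Produces j (H j (iterD r g)))) →
    Build S₀ (suc d ℕ.* (suc d ℕ.* 1)) (Table g)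
  tabulate S₀ entry = forEach² S₀ (λ r j → Produces-⊑) d d entry

  -- Dʳ xᵢ is xᵢ, aᵢ and 0 for r = 0, 1, ≥ 2; each is homogeneous
  varTable : ∀ S₀ i → Build S₀ (suc d ℕ.* (suc d ℕ.* 1)) (Table (varP i))
  varTable S₀ i = tabulate S₀ (λ r j _ _ {S} _ → entry r j S)
    where
    entry : ∀ r j S → Build S 1 (Produces j (H j (iterD r (varP i))))
    entry zero (suc zero) S = mapBuild (λ _ → recast (≋-sym (H-homogeneous 1 (HomDeg-var i)))) (addVar S i)
    entry zero zero S = addZero S 0 (H-other 0 1 (HomDeg-var i) (λ ()))
    entry zero (suc (suc j)) S = addZero S _ (H-other (suc (suc j)) 1 (HomDeg-var i) (λ ()))
    entry (suc zero) zero S = mapBuild (λ _ → recast (≋-sym (begin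
      H 0 (D (varP i))          ≈⟨ H-cong 0 (D-var i) ⟩
      H 0 (constP (lookup a i)) ≈⟨ H-homogeneous 0 (HomDeg-const (lookup a i)) ⟩
      constP (lookup a i)       ∎))) (addConst S (lookup a i))
    entry (suc zero) (suc j) S = addZero S _ (begin
      H (suc j) (D (varP i))          ≈⟨ H-cong (suc j) (D-var i) ⟩
      H (suc j) (constP (lookup a i)) ≈⟨ H-other (suc j) 0 (HomDeg-const (lookup a i)) (λ ()) ⟩
      []                              ∎)
    entry (suc (suc r)) j S = addZero S _ (H-cong j (begin
      iterD (suc (suc r)) (varP i)  ≡⟨ ≡.trans (iterD-suc (suc r) (varP i)) (iterD-suc r (D (varP i))) ⟩
      iterD r (D (D (varP i)))      ≈⟨ iterD-zero r (≋-trans (D-cong (D-var i)) (D-const (lookup a i))) ⟩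
      []                            ∎))

  constTable : ∀ S₀ x → Build S₀ (suc d ℕ.* (suc d ℕ.* 1)) (Table (constP x))
  constTable S₀ x = tabulate S₀ (λ r j _ _ {S} _ → entry r j S)
    where
    entry : ∀ r j S → Build S 1 (Produces j (H j (iterD r (constP x))))
    entry zero zero    S = mapBuild (λ _ → recast (≋-sym (H-homogeneous 0 (HomDeg-const x)))) (addConst S x)
    entry zero (suc j) S = addZero S _ (H-other (suc j) 0 (HomDeg-const x) (λ ()))
    entry (suc r) j    S = addZero S _ (H-cong j (≋-trans (≋-reflexive (iterD-suc r (constP x))) (iterD-zero r (D-const x))))

  -- Hʲ and Dʳ are additive, so tables of sums are entrywise sums
  sumTable : ∀ {g₁ g₂ S₀} → Table g₁ S₀ → Table g₂ S₀ → Build S₀ (suc d ℕ.* (suc d ℕ.* 1)) (Table (g₁ ++ g₂))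
  sumTable {g₁} {g₂} {S₀} t₁ t₂ = tabulate S₀ entry
    where
    entry : ∀ r j → r ≤ d → j ≤ d → ∀ {S} → S₀ ⊑ S → Build S 1 (Produces j (H j (iterD r (g₁ ++ g₂))))
    entry r j r≤d j≤d e = mapBuild (λ _ → recast (≋-sym (begin
        H j (iterD r (g₁ ++ g₂))             ≈⟨ H-cong j (iterD-++ r g₁ g₂) ⟩
        H j (iterD r g₁ ++ iterD r g₂)       ≡⟨ H-++ j (iterD r g₁) (iterD r g₂) ⟩
        H j (iterD r g₁) ++ H j (iterD r g₂) ∎)))
      (addSum (Produces-⊑ e (t₁ r j r≤d j≤d)) (Produces-⊑ e (t₂ r j r≤d j≤d)))

  -- Layer 0 expands Hᵏ of a product into k+1 products
  -- of table entries; layer m+1 is one sum per cell by the Leibniz rule.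
  -- The table of g₁g₂ consists of the cells with q = p = 0.
  module ProductTable {g₁ g₂ : Poly n} {S₀ : HCircuit} (t₁ : Table g₁ S₀) (t₂ : Table g₂ S₀) where

    Cell : ℕ → ℕ → ℕ → ℕ → HCircuit → Set (c ⊔ ℓ)
    Cell m q p k S = q ℕ.+ p ℕ.+ m ≤ d → Produces k (H k (iterD m (iterD q g₁ *P iterD p g₂))) S

    Layer : ℕ → HCircuit → Set (c ⊔ ℓ)
    Layer m S = ∀ q p k → q ≤ d → p ≤ d → k ≤ d → Cell m q p k S

    Layer-⊑ : ∀ m → Monotone (Layer m)
    Layer-⊑ m e L q p k q≤d p≤d k≤d fits = Produces-⊑ e (L q p k q≤d p≤d k≤d fits)

    -- Σ_{j ≤ i} Hʲ(D^q g₁) · Hᵏ⁻ʲ(D^p g₂), one product and one sum per term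
    partialProduct : ∀ q p k i → q ≤ d → p ≤ d → k ≤ d → i ≤ k → ∀ {S} → S₀ ⊑ S →
      Build S (2 ℕ.* suc i) (Produces k (sumTo i (λ j → H j (iterD q g₁) *P H (k ∸ j) (iterD p g₂))))
    partialProduct q p k i q≤d p≤d k≤d i≤k = chain i i≤k
      where
      term : ∀ j → j ≤ k → ∀ {S} → S₀ ⊑ S → Build S 1 (Produces k (H j (iterD q g₁) *P H (k ∸ j) (iterD p g₂)))
      term j j≤k e = mapBuild (λ _ → regrade (ℕP.m+[n∸m]≡n j≤k))
        (addProduct (Produces-⊑ e (t₁ q j q≤d (ℕP.≤-trans j≤k k≤d)))
                    (Produces-⊑ e (t₂ p (k ∸ j) p≤d (ℕP.≤-trans (ℕP.m∸n≤m k j) k≤d))))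
      chain : ∀ i → i ≤ k → ∀ {S} → S₀ ⊑ S →
        Build S (2 ℕ.* suc i) (Produces k (sumTo i (λ j → H j (iterD q g₁) *P H (k ∸ j) (iterD p g₂))))
      chain zero    _   e = relax (s≤s z≤n) (term 0 z≤n e)
      chain (suc i) i<k e = relax (ℕP.≤-reflexive (cost i))
        (chain i (ℕP.≤-trans (ℕP.n≤1+n i) i<k) e >>= λ e₁ acc →
         term (suc i) i<k (⊑-trans e e₁) >>= λ e₂ next →
         addSum (Produces-⊑ e₂ acc) next)
        where
        cost : ∀ i → 2 ℕ.* suc i ℕ.+ (1 ℕ.+ 1) ≡ 2 ℕ.* suc (suc i)
        cost = solve-∀

    layer₀ : Build S₀ (suc d ℕ.* (suc d ℕ.* (suc d ℕ.* (2 ℕ.* suc d)))) (Layer 0)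
    layer₀ = mapBuild (λ _ h q p k q≤d p≤d k≤d _ → h q p k q≤d p≤d k≤d)
      (forEach³ S₀ {R = λ q p k → Produces k (H k (iterD q g₁ *P iterD p g₂))} (λ q p k → Produces-⊑) d
        (λ q p k q≤d p≤d k≤d e → relax (ℕP.*-monoʳ-≤ 2 (s≤s k≤d))
          (mapBuild (λ _ → recast (≋-sym (H-* k (iterD q g₁) (iterD p g₂))))
            (partialProduct q p k k q≤d p≤d k≤d ℕP.≤-refl e))))

    leibniz-step : ∀ m k X Y →
      H k (iterD m (D X *P Y)) ++ H k (iterD m (X *P D Y)) ≋ H k (iterD (suc m) (X *P Y))
    leibniz-step m k X Y = ≋-sym (begin
      H k (iterD (suc m) (X *P Y))                          ≡⟨ ≡.cong (H k) (iterD-suc m (X *P Y)) ⟩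
      H k (iterD m (D (X *P Y)))                            ≈⟨ H-cong k (iterD-cong m (D-leibniz X Y)) ⟩
      H k (iterD m ((D X *P Y) ++ (X *P D Y)))              ≈⟨ H-cong k (iterD-++ m (D X *P Y) (X *P D Y)) ⟩
      H k (iterD m (D X *P Y) ++ iterD m (X *P D Y))        ≡⟨ H-++ k (iterD m (D X *P Y)) (iterD m (X *P D Y)) ⟩
      H k (iterD m (D X *P Y)) ++ H k (iterD m (X *P D Y))  ∎)

    nextLayer : ∀ m {S} → Layer m S → Build S (suc d ℕ.* (suc d ℕ.* (suc d ℕ.* 1))) (Layer (suc m))
    nextLayer m {S} L = forEach³ S (λ q p k → Cell-⊑ {q} {p} {k}) d cell
      where
      Cell-⊑ : ∀ {q p k} → Monotone (Cell (suc m) q p k)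
      Cell-⊑ e h fits = Produces-⊑ e (h fits)
      shiftˡ : ∀ q p → suc q ℕ.+ p ℕ.+ m ≡ q ℕ.+ p ℕ.+ suc m
      shiftˡ = solve-∀
      shiftʳ : ∀ q p → q ℕ.+ suc p ℕ.+ m ≡ q ℕ.+ p ℕ.+ suc m
      shiftʳ = solve-∀
      cell : ∀ q p k → q ≤ d → p ≤ d → k ≤ d → ∀ {S′} → S ⊑ S′ → Build S′ 1 (Cell (suc m) q p k)
      cell q p k q≤d p≤d k≤d e with q ℕ.+ p ℕ.+ suc m ℕP.≤? d
      ... | no  doesn't-fit = done (λ fits → ⊥-elim (doesn't-fit fits))
      ... | yes fits = mapBuild (λ _ h _ → recast (leibniz-step m k (iterD q g₁) (iterD p g₂)) h)
        (addSum (Produces-⊑ e (L (suc q) p k sq≤d p≤d k≤d fitsˡ)) (Produces-⊑ e (L q (suc p) k q≤d sp≤d k≤d fitsʳ)))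
        where
        fitsˡ = ≡.subst (_≤ d) (≡.sym (shiftˡ q p)) fits
        fitsʳ = ≡.subst (_≤ d) (≡.sym (shiftʳ q p)) fits
        sq≤d = ℕP.≤-trans (ℕP.m≤m+n (suc q) p) (ℕP.≤-trans (ℕP.m≤m+n (suc q ℕ.+ p) m) fitsˡ)
        sp≤d = ℕP.≤-trans (ℕP.m≤n+m (suc p) q) (ℕP.≤-trans (ℕP.m≤m+n (q ℕ.+ suc p) m) fitsʳ)

    productTable : Build S₀ (suc d ℕ.* (suc d ℕ.* (suc d ℕ.* (2 ℕ.* suc d))) ℕ.+ d ℕ.* (suc d ℕ.* (suc d ℕ.* (suc d ℕ.* 1))))
                         (Table (g₁ *P g₂))
    productTable = mapBuild (λ _ layers r k r≤d k≤d → layers r r≤d 0 0 k z≤n z≤n k≤d r≤d)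
      (stages S₀ Layer-⊑ layer₀ nextLayer d)

module Construction {c ℓ : Level} (F : Field c ℓ) {n : ℕ} (a : Vec (Field.Carrier F) n) (d : ℕ) where
  open Field F
  open FieldDefs F
  open PolynomialAlgebra F
  open DirectionalDerivative F a
  open CircuitBuilding F {n}
  open GateTables F a d

  budget : ℕ
  budget = 3 ℕ.* (suc d ℕ.^ 4)

  table-within-budget : suc d ℕ.* (suc d ℕ.* 1) ≤ budget
  table-within-budget = ℕP.≤-trans (ℕP.m≤m*n (suc d ℕ.* (suc d ℕ.* 1)) (3 ℕ.* suc d ℕ.* suc d))
                                   (ℕP.≤-reflexive (expand (suc d)))
    where
    expand : ∀ x → x ℕ.* (x ℕ.* 1) ℕ.* (3 ℕ.* x ℕ.* x) ≡ 3 ℕ.* (x ℕ.* (x ℕ.* (x ℕ.* (x ℕ.* 1))))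
    expand = solve-∀

  -- layer 0 costs 2(d+1)⁴ and each of the d further layers (d+1)³
  product-within-budget :
    suc d ℕ.* (suc d ℕ.* (suc d ℕ.* (2 ℕ.* suc d))) ℕ.+ d ℕ.* (suc d ℕ.* (suc d ℕ.* (suc d ℕ.* 1))) ≤ budget
  product-within-budget = ℕP.≤-trans (ℕP.+-monoʳ-≤ _ (ℕP.*-monoˡ-≤ _ (ℕP.n≤1+n d))) (ℕP.≤-reflexive (expand (suc d)))
    where
    expand : ∀ x → x ℕ.* (x ℕ.* (x ℕ.* (2 ℕ.* x))) ℕ.+ x ℕ.* (x ℕ.* (x ℕ.* (x ℕ.* 1)))
                   ≡ 3 ℕ.* (x ℕ.* (x ℕ.* (x ℕ.* (x ℕ.* 1))))
    expand = solve-∀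

  gateTable : ∀ {s} (Φ : Circuit n s) g {S} → (∀ j → Table (gatePoly Φ j) S) →
    Build S budget (Table (gateSem g (evalAll Φ)))
  gateTable Φ (var i)   ts = relax table-within-budget (varTable _ i)
  gateTable Φ (const x) ts = relax table-within-budget (constTable _ x)
  gateTable Φ (add i j) ts = relax table-within-budget (sumTable (ts i) (ts j))
  gateTable Φ (mul i j) ts = relax product-within-budget (ProductTable.productTable (ts i) (ts j))

  empty : HCircuit
  empty = ⟨ [] , (λ ()) ⟩

  allTables : ∀ {s} (Φ : Circuit n s) → Build empty (s ℕ.* budget) (λ S → ∀ j → Table (gatePoly Φ j) S)
  allTables []              = done (λ ())
  allTables {suc s} (Φ ▷ g) = relax (ℕP.≤-reflexive (ℕP.+-comm (s ℕ.* budget) budget))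
    (allTables Φ >>= λ _ ts → mapBuild (λ e t → extend e ts t) (gateTable Φ g ts))
    where
    extend : ∀ {S S′} → S ⊑ S′ → (∀ j → Table (gatePoly Φ j) S) → Table (gateSem g (evalAll Φ)) S′ →
      ∀ j → Table (gatePoly (Φ ▷ g) j) S′
    extend e ts t Fin.zero    = t
    extend e ts t (Fin.suc j) = Table-⊑ e (ts j)

  computesVia : ∀ {S k X Y} → Produces k X S → X ≋ Y → Computes (circuit S) Y
  computesVia h X≋Y = gate h , at (≋-trans (computes h) X≋Y)

  tablesAndZero : ∀ {s} (Φ : Circuit n s) →
    Build empty (s ℕ.* budget ℕ.+ 1) (λ S → (∀ j → Table (gatePoly Φ j) S) × Produces 0 [] S)
  tablesAndZero Φ = allTables Φ >>= λ _ ts → mapBuild (λ e z → (λ j → Table-⊑ e (ts j)) , z) (addZero _ 0 ≋-refl)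

  -- Tables of all gates plus one zero gate.  The table of the output gate
  -- contains every f_k^{(r)} with r ≤ k; the others are zero.
  homogeneousCircuit : ∀ {s} (Φ : Circuit n s) f → Computes Φ f →
    Σ ℕ λ s′ → Σ (Circuit n s′) λ Ψ →
      (s′ ≤ 4 ℕ.* (suc d ℕ.^ 4) ℕ.* s) ×
      IsHomogeneousCircuit Ψ ×
      (∀ k r → k ≤ d → r ≤ d → Computes Ψ (fder k r a f))
  homogeneousCircuit {s} Φ f (out , out≋f) with tablesAndZero Φ
  ... | built {result = S} _ (tables , zeroGate) size≤ = size S , circuit S , size-bound , homogeneous S , entry
    where
    size-bound : size S ≤ 4 ℕ.* (suc d ℕ.^ 4) ℕ.* s
    size-bound = ℕP.≤-trans size≤ (total-size s out)
      where
      X = suc d ℕ.^ 4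
      regroup : ∀ s X → s ℕ.* (3 ℕ.* X) ℕ.+ X ℕ.* s ≡ 4 ℕ.* X ℕ.* s
      regroup = solve-∀
      -- the extra zero gate is paid for because the input circuit has a gate
      total-size : ∀ s → Fin s → s ℕ.* budget ℕ.+ 1 ≤ 4 ℕ.* X ℕ.* s
      total-size (suc s) _ = ℕP.≤-trans (ℕP.+-monoʳ-≤ (suc s ℕ.* budget) (ℕP.*-mono-≤ (ℕP.m^n>0 (suc d) 4) (s≤s z≤n)))
                                        (ℕP.≤-reflexive (regroup (suc s) X))
    entry : ∀ k r → k ≤ d → r ≤ d → Computes (circuit S) (fder k r a f)
    entry k r k≤d r≤d with r ℕP.≤? k
    ... | yes r≤k = computesVia (tables out r (k ∸ r) r≤d (ℕP.≤-trans (ℕP.m∸n≤m k r) k≤d))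
                                (≋-trans (H-cong (k ∸ r) (iterD-cong r ⟪ out≋f ⟫)) (≋-sym (fder-lowered f r≤k)))
    ... | no  r≰k = computesVia zeroGate (≋-sym (fder-vanishes f (ℕP.≰⇒> r≰k)))

open import Data.Nat using (_*_; _^_)

corollary3p8 : ∀ {c ℓ : Level} → Σ ℕ λ C →
    (F : Field c ℓ) → let open FieldDefs F in
    (n d s : ℕ) (f : Poly n) →
    CharZeroOrGreaterThan d →
    HasDegree f d →
    (Φ : Circuit n s) → Computes Φ f →
    (a : Vec (Field.Carrier F) n) →
    Σ ℕ λ s′ → Σ (Circuit n s′) λ Ψ →
      (s′ ≤ C * (suc d ^ 4) * s) ×
      IsHomogeneousCircuit Ψ ×
      (∀ k r → k ≤ d → r ≤ d → Computes Ψ (fder k r a f))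
corollary3p8 = 4 , λ F n d s f _ _ Φ Φ-computes-f a → Construction.homogeneousCircuit F a d Φ f Φ-computes-f
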